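{- Let $K$ be a field of characteristic $0$ with a discrete valuation $v$, $v(K^\times)=\mathbb Z$, valuation ring $\mathcal O_v$ and residue field $k_v$ of characteristic $p>0$. Suppose $\varphi\in K[x]$ has degree $d$ divisible by $p$, has good reduction at $v$, and is post-critically finite. Then the image of $\varphi'$ in $k_v[x]$ is identically $0$.
   Context: $\varphi=\sum_{j=0}^d a_jx^j$ has good reduction at $v$ if $0=v(a_d)\le v(a_j)$ for $0\le j\le d-1$. $\varphi$ is post-critically finite if every root of $\varphi'$ in an algebraic closure of $K$ has finite forward orbit under iteration of $\varphi$. -}

module Defs where

open import Level using (Level; _⊔_) renaming (suc to lsuc)
open import Data.Nat as ℕ using (ℕ; zero; suc)
open import Data.Nat.Primality using (Prime)
open import Data.Nat.Divisibility using (_∣_)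
open import Data.Integer as ℤ using (ℤ; +_)
open import Data.Fin using (Fin; fromℕ; inject₁)
import Data.Fin as Fin
open import Data.Product using (Σ; ∃; _×_; _,_)
open import Relation.Nullary using (¬_)
open import Relation.Binary.PropositionalEquality using (_≡_)
open import Function using (_∘_)
open import Algebra.Bundles using (CommutativeRing)
open import Algebra.Morphism.Structures using (module RingMorphisms)

record Field (c ℓ : Level) : Set (lsuc (c ⊔ ℓ)) where
  field
    commutativeRing : CommutativeRing c ℓ
  open CommutativeRing commutativeRing public
  field
    1≉0     : ¬ (1# ≈ 0#)
    inverse : ∀ x → ¬ (x ≈ 0#) → Σ Carrier λ y → x * y ≈ 1#

module FieldOps {c ℓ} (F : Field c ℓ) where
  open Field F

  _·_ : ℕ → Carrier → Carrier
  zero  · x = 0#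
  suc n · x = x + (n · x)

  _^_ : Carrier → ℕ → Carrier
  x ^ zero  = 1#
  x ^ suc n = x * (x ^ n)

  -- A polynomial with n coefficients (indices 0 .. n-1), a j = coefficient of x^j.
  -- eval n a x = Σ_{j<n} a_j x^j
  eval : (n : ℕ) → (Fin n → Carrier) → Carrier → Carrier
  eval zero    a x = 0#
  eval (suc n) a x = a Fin.zero + x * eval n (a ∘ Fin.suc) x

  deriv : (d : ℕ) → (Fin (suc d) → Carrier) → Fin d → Carrier
  deriv d a j = suc (Fin.toℕ j) · a (Fin.suc j)

  iter : (n : ℕ) → (Carrier → Carrier) → Carrier → Carrier
  iter zero    f x = x
  iter (suc n) f x = f (iter n f x)

  CharZero : Set ℓ
  CharZero = ∀ n → ¬ (suc n · 1# ≈ 0#)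

  FiniteOrbit : (Carrier → Carrier) → Carrier → Set (c ⊔ ℓ)
  FiniteOrbit f x = Σ ℕ λ N → Σ (Fin N → Carrier) λ e →
                    ∀ n → Σ (Fin N) λ i → iter n f x ≈ e i

  AlgClosed : Set (c ⊔ ℓ)
  AlgClosed = ∀ n (a : Fin (suc (suc n)) → Carrier) →
              ¬ (a (fromℕ (suc n)) ≈ 0#) →
              Σ Carrier λ α → eval (suc (suc n)) a α ≈ 0#

data ℤ∞ : Set where
  fin : ℤ → ℤ∞
  ∞   : ℤ∞

infix 4 _≤∞_
data _≤∞_ : ℤ∞ → ℤ∞ → Set where
  fin≤fin : ∀ {m n} → m ℤ.≤ n → fin m ≤∞ fin n
  _≤∞∞    : ∀ x → x ≤∞ ∞

_+∞_ : ℤ∞ → ℤ∞ → ℤ∞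
fin m +∞ fin n = fin (m ℤ.+ n)
fin m +∞ ∞     = ∞
∞     +∞ y     = ∞

min∞ : ℤ∞ → ℤ∞ → ℤ∞
min∞ (fin m) (fin n) = fin (m ℤ.⊓ n)
min∞ (fin m) ∞       = fin m
min∞ ∞       y       = y

record DiscreteValuation {c ℓ} (K : Field c ℓ) : Set (c ⊔ ℓ) where
  open Field K
  field
    v          : Carrier → ℤ∞
    v-cong     : ∀ {x y} → x ≈ y → v x ≡ v y
    v-∞⇒0      : ∀ x → v x ≡ ∞ → x ≈ 0#
    v-0        : v 0# ≡ ∞
    v-mult     : ∀ x y → v (x * y) ≡ v x +∞ v y
    v-ultra    : ∀ x y → min∞ (v x) (v y) ≤∞ v (x + y)
    v-surj     : ∀ (z : ℤ) → Σ Carrier λ x → v x ≡ fin z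

  -- x lies in the maximal ideal m_v, i.e. its image in k_v = O_v/m_v is 0
  InMaxIdeal : Carrier → Set
  InMaxIdeal x = fin (+ 1) ≤∞ v x

  Integral : Carrier → Set
  Integral x = fin (+ 0) ≤∞ v x

record AlgebraicClosure {c ℓ} (K : Field c ℓ) (c' ℓ' : Level)
       : Set (lsuc (c' ⊔ ℓ') ⊔ c ⊔ ℓ) where
  field
    L : Field c' ℓ'
  open FieldOps L public
  field
    ι           : Field.Carrier K → Field.Carrier L
    ι-hom       : RingMorphisms.IsRingHomomorphism
                    (Field.rawRing K) (Field.rawRing L) ι
    closed      : AlgClosed
    algebraic   : ∀ (y : Field.Carrier L) → Σ ℕ λ n →
                  Σ (Fin (suc n) → Field.Carrier K) λ a →
                  ¬ (Field._≈_ K (a (fromℕ n)) (Field.0# K)) ×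
                  Field._≈_ L (eval (suc n) (ι ∘ a) y) (Field.0# L)

PostCriticallyFinite : ∀ {c ℓ c' ℓ'} (K : Field c ℓ) →
  AlgebraicClosure K c' ℓ' → (d : ℕ) → (Fin (suc d) → Field.Carrier K) →
  Set (c' ⊔ ℓ')
PostCriticallyFinite K Kbar d a =
  ∀ (α : Field.Carrier L) →
    Field._≈_ L (eval d (deriv d (ι ∘ a)) α) (Field.0# L) →
    FiniteOrbit (eval (suc d) (ι ∘ a)) α
  where open AlgebraicClosure Kbar

GoodReduction : ∀ {c ℓ} (K : Field c ℓ) → DiscreteValuation K →
  (d : ℕ) → (Fin (suc d) → Field.Carrier K) → Set
GoodReduction K V d a =
  (v (a (fromℕ d)) ≡ fin (+ 0)) × (∀ j → Integral (a j))
  where open DiscreteValuation V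

-- Let β be a root of φ' in K̄. Its orbit is finite, so φ^m(β) = φ^n(β) for some m < n, and β is a
-- root of φ^n − φ^m, which, like φ, has integral coefficients and a unit leading coefficient.
-- Splitting off the roots of φ' one at a time, φ' divides over K̄ a product P of such polynomials,
-- and by uniqueness of division with remainder P = φ' q already over K. Gauss's lemma gives
-- min v(φ') + min v(q) = min v(P) ≥ 0, while comparing leading coefficients gives
-- v(lead q) = −v(d a_d). Hence every coefficient of φ' has valuation at least v(d) ≥ v(p) ≥ 1.

module Submission where

open import Defs
open import Level using (Level; _⊔_)
open import Data.Nat as ℕ using (ℕ; zero; suc; z≤n; s≤s)
import Data.Nat.Properties as ℕP
open import Data.Nat.Primality using (Prime; prime⇒nonTrivial)
open import Data.Nat.Divisibility using (_∣_; divides; ∣⇒≤)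
open import Data.Integer as ℤ using (ℤ; +_; -[1+_])
import Data.Integer.Properties as ℤP
open import Data.Fin as Fin using (Fin; toℕ; fromℕ)
import Data.Fin.Properties as FinP
open import Data.List using (List; []; _∷_; map; tabulate; length)
import Data.List.Properties as ListP
open import Data.Maybe using (nothing)
open import Data.Product using (Σ; _×_; _,_; proj₁; proj₂)
open import Data.Sum using (_⊎_; inj₁; inj₂)
open import Data.Empty using (⊥-elim)
open import Function using (_∘_)
open import Relation.Nullary using (¬_; Dec; yes; no)
open import Relation.Binary.PropositionalEquality as ≡ using (_≡_)
open import Algebra.Bundles using (CommutativeRing; Semiring)
open import Relation.Binary.Bundles using (Setoid)
open import Algebra.Morphism.Structures using (module RingMorphisms)

module Polynomial {c ℓ} (R : CommutativeRing c ℓ) where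
  open CommutativeRing R hiding (zero)
  open import Algebra.Definitions.RawSemiring (Semiring.rawSemiring semiring) public using (_^_)
  open import Algebra.Properties.Ring ring using (-0#≈0#; -1*x≈-x; -‿distribʳ-*; -‿+-comm)
  open import Algebra.Properties.AbelianGroup +-abelianGroup using (xyx⁻¹≈y)
  open import Algebra.Properties.CommutativeSemigroup +-commutativeSemigroup
    using (interchange) renaming (x∙yz≈y∙xz to x+yz≈y+xz)
  open import Algebra.Properties.CommutativeSemigroup *-commutativeSemigroup
    using () renaming (x∙yz≈y∙xz to x*yz≈y*xz)
  open import Tactic.RingSolver.Core.AlmostCommutativeRing using (fromCommutativeRing)
  open import Tactic.RingSolver.Core.Expression using (_⊕_; _⊗_)
  open import Tactic.RingSolver.NonReflective (fromCommutativeRing R (λ _ → nothing)) using (solve; _⊜_)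
  open import Relation.Binary.Reasoning.Setoid setoid

  -- Coefficient lists, constant term first; trailing zeros are allowed, so equality is _≋_.
  Poly : Set c
  Poly = List Carrier

  coeff : Poly → ℕ → Carrier
  coeff []      _       = 0#
  coeff (a ∷ f) zero    = a
  coeff (a ∷ f) (suc i) = coeff f i

  coeffX : Poly → ℕ → Carrier
  coeffX f = coeff (0# ∷ f)

  infix 4 _≋_
  record _≋_ (f g : Poly) : Set ℓ where
    constructor mk≋
    field at : ∀ i → coeff f i ≈ coeff g i
  open _≋_ public

  ≋-refl : ∀ {f} → f ≋ f
  ≋-refl .at i = refl

  ≋-reflexive : ∀ {f g} → f ≡ g → f ≋ g
  ≋-reflexive ≡.refl = ≋-refl

  ≋-sym : ∀ {f g} → f ≋ g → g ≋ f
  ≋-sym p .at i = sym (at p i)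

  ≋-trans : ∀ {f g h} → f ≋ g → g ≋ h → f ≋ h
  ≋-trans p q .at i = trans (at p i) (at q i)

  ≋-setoid : Setoid c ℓ
  ≋-setoid = record
    { Carrier       = Poly
    ; _≈_           = _≋_
    ; isEquivalence = record { refl = ≋-refl ; sym = ≋-sym ; trans = ≋-trans } }

  ∷-cong : ∀ {a b f g} → a ≈ b → f ≋ g → a ∷ f ≋ b ∷ g
  ∷-cong p q .at zero    = p
  ∷-cong p q .at (suc i) = at q i

  ≋-tail : ∀ {a b f g} → a ∷ f ≋ b ∷ g → f ≋ g
  ≋-tail p .at i = at p (suc i)

  coeffX-cong : ∀ {f g} → f ≋ g → ∀ i → coeffX f i ≈ coeffX g i
  coeffX-cong p = at (∷-cong refl p)

  IsZero : Poly → Set ℓ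
  IsZero f = ∀ i → coeff f i ≈ 0#

  IsZero-tail : ∀ {a f} → IsZero (a ∷ f) → IsZero f
  IsZero-tail z i = z (suc i)

  coeffX-IsZero : ∀ {f} → IsZero f → ∀ i → coeffX f i ≈ 0#
  coeffX-IsZero z zero    = refl
  coeffX-IsZero z (suc i) = z i

  Deg< : Poly → ℕ → Set ℓ
  Deg< f n = ∀ i → n ℕ.≤ i → coeff f i ≈ 0#

  Deg<-weaken : ∀ {f m n} → m ℕ.≤ n → Deg< f m → Deg< f n
  Deg<-weaken m≤n b i n≤i = b i (ℕP.≤-trans m≤n n≤i)

  Deg<-tail : ∀ {a f n} → Deg< (a ∷ f) (suc n) → Deg< f n
  Deg<-tail b i n≤i = b (suc i) (s≤s n≤i)

  Deg<-0⇒IsZero : ∀ {f} → Deg< f 0 → IsZero f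
  Deg<-0⇒IsZero b i = b i z≤n

  Deg<-length : ∀ f → Deg< f (length f)
  Deg<-length []      i       _         = refl
  Deg<-length (a ∷ f) (suc i) (s≤s le) = Deg<-length f i le

  Deg<-cong : ∀ {f g n} → f ≋ g → Deg< f n → Deg< g n
  Deg<-cong p b i le = trans (sym (at p i)) (b i le)

  infixl 6 _+ₚ_ _-ₚ_
  infixl 7 _*ₚ_

  _+ₚ_ : Poly → Poly → Poly
  []      +ₚ g       = g
  (a ∷ f) +ₚ []      = a ∷ f
  (a ∷ f) +ₚ (b ∷ g) = (a + b) ∷ (f +ₚ g)

  coeff-+ₚ : ∀ f g i → coeff (f +ₚ g) i ≈ coeff f i + coeff g i
  coeff-+ₚ []      g       i       = sym (+-identityˡ _)
  coeff-+ₚ (a ∷ f) []      i       = sym (+-identityʳ _)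
  coeff-+ₚ (a ∷ f) (b ∷ g) zero    = refl
  coeff-+ₚ (a ∷ f) (b ∷ g) (suc i) = coeff-+ₚ f g i

  +ₚ-cong : ∀ {f f' g g'} → f ≋ f' → g ≋ g' → f +ₚ g ≋ f' +ₚ g'
  +ₚ-cong {f} {f'} {g} {g'} p q .at i = begin
    coeff (f +ₚ g) i        ≈⟨ coeff-+ₚ f g i ⟩
    coeff f i + coeff g i   ≈⟨ +-cong (at p i) (at q i) ⟩
    coeff f' i + coeff g' i ≈⟨ coeff-+ₚ f' g' i ⟨
    coeff (f' +ₚ g') i      ∎

  +ₚ-IsZeroʳ : ∀ f {z} → IsZero z → f +ₚ z ≋ f
  +ₚ-IsZeroʳ f {z} z≈0 .at i = trans (coeff-+ₚ f z i) (trans (+-cong refl (z≈0 i)) (+-identityʳ _))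

  Deg<-+ₚ : ∀ {f g n} → Deg< f n → Deg< g n → Deg< (f +ₚ g) n
  Deg<-+ₚ {f} {g} bf bg i le = trans (coeff-+ₚ f g i) (trans (+-cong (bf i le) (bg i le)) (+-identityʳ 0#))

  negₚ : Poly → Poly
  negₚ = map (λ x → - x)

  _-ₚ_ : Poly → Poly → Poly
  f -ₚ g = f +ₚ negₚ g

  coeff-negₚ : ∀ f i → coeff (negₚ f) i ≈ - coeff f i
  coeff-negₚ []      i       = sym -0#≈0#
  coeff-negₚ (a ∷ f) zero    = refl
  coeff-negₚ (a ∷ f) (suc i) = coeff-negₚ f i

  coeff--ₚ : ∀ f g i → coeff (f -ₚ g) i ≈ coeff f i - coeff g i
  coeff--ₚ f g i = trans (coeff-+ₚ f (negₚ g) i) (+-cong refl (coeff-negₚ g i))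

  -ₚ-cong : ∀ {f f' g g'} → f ≋ f' → g ≋ g' → f -ₚ g ≋ f' -ₚ g'
  -ₚ-cong {f} {f'} {g} {g'} p q .at i =
    trans (coeff--ₚ f g i) (trans (+-cong (at p i) (-‿cong (at q i))) (sym (coeff--ₚ f' g' i)))

  +ₚ--ₚ-cancelˡ : ∀ f g → (f +ₚ g) -ₚ f ≋ g
  +ₚ--ₚ-cancelˡ f g .at i = begin
    coeff ((f +ₚ g) -ₚ f) i             ≈⟨ coeff--ₚ (f +ₚ g) f i ⟩
    coeff (f +ₚ g) i - coeff f i        ≈⟨ +-cong (coeff-+ₚ f g i) refl ⟩
    coeff f i + coeff g i - coeff f i   ≈⟨ xyx⁻¹≈y _ _ ⟩
    coeff g i                           ∎

  Deg<-negₚ : ∀ {f n} → Deg< f n → Deg< (negₚ f) n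
  Deg<-negₚ {f} b i le = trans (coeff-negₚ f i) (trans (-‿cong (b i le)) -0#≈0#)

  scale : Carrier → Poly → Poly
  scale a = map (a *_)

  coeff-scale : ∀ a f i → coeff (scale a f) i ≈ a * coeff f i
  coeff-scale a []      i       = sym (zeroʳ a)
  coeff-scale a (b ∷ f) zero    = refl
  coeff-scale a (b ∷ f) (suc i) = coeff-scale a f i

  scale-cong : ∀ {a b f g} → a ≈ b → f ≋ g → scale a f ≋ scale b g
  scale-cong {a} {b} {f} {g} p q .at i =
    trans (coeff-scale a f i) (trans (*-cong p (at q i)) (sym (coeff-scale b g i)))

  negₚ≋scale-1 : ∀ f → negₚ f ≋ scale (- 1#) f
  negₚ≋scale-1 f .at i = begin
    coeff (negₚ f) i         ≈⟨ coeff-negₚ f i ⟩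
    - coeff f i              ≈⟨ -1*x≈-x _ ⟨
    - 1# * coeff f i         ≈⟨ coeff-scale (- 1#) f i ⟨
    coeff (scale (- 1#) f) i ∎

  _*ₚ_ : Poly → Poly → Poly
  []      *ₚ g = []
  (a ∷ f) *ₚ g = scale a g +ₚ (0# ∷ f *ₚ g)

  coeff-∷-*ₚ : ∀ a f g i → coeff ((a ∷ f) *ₚ g) i ≈ a * coeff g i + coeffX (f *ₚ g) i
  coeff-∷-*ₚ a f g i = trans (coeff-+ₚ (scale a g) _ i) (+-cong (coeff-scale a g i) refl)

  IsZero-*ₚˡ : ∀ f g → IsZero f → IsZero (f *ₚ g)
  IsZero-*ₚˡ []      g z i = refl
  IsZero-*ₚˡ (a ∷ f) g z i = begin
    coeff ((a ∷ f) *ₚ g) i          ≈⟨ coeff-∷-*ₚ a f g i ⟩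
    a * coeff g i + coeffX (f *ₚ g) i ≈⟨ +-cong (trans (*-cong (z zero) refl) (zeroˡ _))
                                                (coeffX-IsZero (IsZero-*ₚˡ f g (IsZero-tail z)) i) ⟩
    0# + 0#                         ≈⟨ +-identityʳ 0# ⟩
    0#                              ∎

  IsZero-*ₚʳ : ∀ f g → IsZero g → IsZero (f *ₚ g)
  IsZero-*ₚʳ []      g z i = refl
  IsZero-*ₚʳ (a ∷ f) g z i = begin
    coeff ((a ∷ f) *ₚ g) i          ≈⟨ coeff-∷-*ₚ a f g i ⟩
    a * coeff g i + coeffX (f *ₚ g) i ≈⟨ +-cong (trans (*-cong refl (z i)) (zeroʳ a))
                                                (coeffX-IsZero (IsZero-*ₚʳ f g z) i) ⟩
    0# + 0#                         ≈⟨ +-identityʳ 0# ⟩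
    0#                              ∎

  *ₚ-congʳ : ∀ f {g g'} → g ≋ g' → f *ₚ g ≋ f *ₚ g'
  *ₚ-congʳ []      p .at i = refl
  *ₚ-congʳ (a ∷ f) {g} {g'} p .at i = begin
    coeff ((a ∷ f) *ₚ g) i             ≈⟨ coeff-∷-*ₚ a f g i ⟩
    a * coeff g i + coeffX (f *ₚ g) i   ≈⟨ +-cong (*-cong refl (at p i)) (coeffX-cong (*ₚ-congʳ f p) i) ⟩
    a * coeff g' i + coeffX (f *ₚ g') i ≈⟨ coeff-∷-*ₚ a f g' i ⟨
    coeff ((a ∷ f) *ₚ g') i            ∎

  *ₚ-congˡ : ∀ {f f'} g → f ≋ f' → f *ₚ g ≋ f' *ₚ g
  *ₚ-congˡ {[]}    {[]}     g p .at i = refl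
  *ₚ-congˡ {[]}    {b ∷ f'} g p .at i = sym (IsZero-*ₚˡ (b ∷ f') g (λ j → sym (at p j)) i)
  *ₚ-congˡ {a ∷ f} {[]}     g p .at i = IsZero-*ₚˡ (a ∷ f) g (at p) i
  *ₚ-congˡ {a ∷ f} {b ∷ f'} g p .at i = begin
    coeff ((a ∷ f) *ₚ g) i             ≈⟨ coeff-∷-*ₚ a f g i ⟩
    a * coeff g i + coeffX (f *ₚ g) i   ≈⟨ +-cong (*-cong (at p zero) refl) (coeffX-cong (*ₚ-congˡ g (≋-tail p)) i) ⟩
    b * coeff g i + coeffX (f' *ₚ g) i  ≈⟨ coeff-∷-*ₚ b f' g i ⟨
    coeff ((b ∷ f') *ₚ g) i            ∎

  *ₚ-cong : ∀ {f f' g g'} → f ≋ f' → g ≋ g' → f *ₚ g ≋ f' *ₚ g'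
  *ₚ-cong {f} {f'} {g} p q = ≋-trans (*ₚ-congˡ g p) (*ₚ-congʳ f' q)

  *ₚ-∷ʳ : ∀ f b g → f *ₚ (b ∷ g) ≋ scale b f +ₚ (0# ∷ f *ₚ g)
  *ₚ-∷ʳ []      b g .at zero    = refl
  *ₚ-∷ʳ []      b g .at (suc i) = refl
  *ₚ-∷ʳ (a ∷ f) b g .at zero    =
    trans (+-cong (*-comm a b) refl) (sym (coeff-+ₚ (scale b (a ∷ f)) (0# ∷ (a ∷ f) *ₚ g) zero))
  *ₚ-∷ʳ (a ∷ f) b g .at (suc i) = begin
    coeff ((a ∷ f) *ₚ (b ∷ g)) (suc i)
      ≈⟨ coeff-∷-*ₚ a f (b ∷ g) (suc i) ⟩
    a * coeff g i + coeff (f *ₚ (b ∷ g)) i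
      ≈⟨ +-cong refl (trans (at (*ₚ-∷ʳ f b g) i) (trans (coeff-+ₚ (scale b f) _ i) (+-cong (coeff-scale b f i) refl))) ⟩
    a * coeff g i + (b * coeff f i + coeffX (f *ₚ g) i)
      ≈⟨ x+yz≈y+xz _ _ _ ⟩
    b * coeff f i + (a * coeff g i + coeffX (f *ₚ g) i)
      ≈⟨ +-cong (sym (coeff-scale b f i)) (sym (coeff-∷-*ₚ a f g i)) ⟩
    coeff (scale b f) i + coeff ((a ∷ f) *ₚ g) i
      ≈⟨ coeff-+ₚ (scale b (a ∷ f)) (0# ∷ (a ∷ f) *ₚ g) (suc i) ⟨
    coeff (scale b (a ∷ f) +ₚ (0# ∷ (a ∷ f) *ₚ g)) (suc i) ∎

  *ₚ-comm : ∀ f g → f *ₚ g ≋ g *ₚ f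
  *ₚ-comm []      g .at i = sym (IsZero-*ₚʳ g [] (λ _ → refl) i)
  *ₚ-comm (a ∷ f) g = ≋-trans (+ₚ-cong ≋-refl (∷-cong refl (*ₚ-comm f g))) (≋-sym (*ₚ-∷ʳ g a f))

  coeffX-+ₚ : ∀ f g i → coeffX (f +ₚ g) i ≈ coeffX f i + coeffX g i
  coeffX-+ₚ f g zero    = sym (+-identityʳ 0#)
  coeffX-+ₚ f g (suc i) = coeff-+ₚ f g i

  coeffX-scale : ∀ a f i → coeffX (scale a f) i ≈ a * coeffX f i
  coeffX-scale a f zero    = sym (zeroʳ a)
  coeffX-scale a f (suc i) = coeff-scale a f i

  *ₚ-distribˡ-+ₚ : ∀ f g h → f *ₚ (g +ₚ h) ≋ f *ₚ g +ₚ f *ₚ h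
  *ₚ-distribˡ-+ₚ []      g h .at i = refl
  *ₚ-distribˡ-+ₚ (a ∷ f) g h .at i = begin
    coeff ((a ∷ f) *ₚ (g +ₚ h)) i
      ≈⟨ coeff-∷-*ₚ a f (g +ₚ h) i ⟩
    a * coeff (g +ₚ h) i + coeffX (f *ₚ (g +ₚ h)) i
      ≈⟨ +-cong (*-cong refl (coeff-+ₚ g h i))
                (trans (coeffX-cong (*ₚ-distribˡ-+ₚ f g h) i) (coeffX-+ₚ (f *ₚ g) (f *ₚ h) i)) ⟩
    a * (coeff g i + coeff h i) + (coeffX (f *ₚ g) i + coeffX (f *ₚ h) i)
      ≈⟨ +-cong (distribˡ a _ _) refl ⟩
    (a * coeff g i + a * coeff h i) + (coeffX (f *ₚ g) i + coeffX (f *ₚ h) i)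
      ≈⟨ interchange _ _ _ _ ⟩
    (a * coeff g i + coeffX (f *ₚ g) i) + (a * coeff h i + coeffX (f *ₚ h) i)
      ≈⟨ +-cong (coeff-∷-*ₚ a f g i) (coeff-∷-*ₚ a f h i) ⟨
    coeff ((a ∷ f) *ₚ g) i + coeff ((a ∷ f) *ₚ h) i
      ≈⟨ coeff-+ₚ ((a ∷ f) *ₚ g) _ i ⟨
    coeff ((a ∷ f) *ₚ g +ₚ (a ∷ f) *ₚ h) i ∎

  *ₚ-distribʳ-+ₚ : ∀ f g h → (g +ₚ h) *ₚ f ≋ g *ₚ f +ₚ h *ₚ f
  *ₚ-distribʳ-+ₚ f g h =
    ≋-trans (*ₚ-comm (g +ₚ h) f) (≋-trans (*ₚ-distribˡ-+ₚ f g h) (+ₚ-cong (*ₚ-comm f g) (*ₚ-comm f h)))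

  scale-*ₚ : ∀ a g h → scale a g *ₚ h ≋ scale a (g *ₚ h)
  scale-*ₚ a []      h .at i = refl
  scale-*ₚ a (b ∷ g) h .at i = begin
    coeff ((a * b ∷ scale a g) *ₚ h) i
      ≈⟨ coeff-∷-*ₚ (a * b) (scale a g) h i ⟩
    (a * b) * coeff h i + coeffX (scale a g *ₚ h) i
      ≈⟨ +-cong (*-assoc a b _) (trans (coeffX-cong (scale-*ₚ a g h) i) (coeffX-scale a (g *ₚ h) i)) ⟩
    a * (b * coeff h i) + a * coeffX (g *ₚ h) i
      ≈⟨ distribˡ a _ _ ⟨
    a * (b * coeff h i + coeffX (g *ₚ h) i)
      ≈⟨ *-cong refl (coeff-∷-*ₚ b g h i) ⟨
    a * coeff ((b ∷ g) *ₚ h) i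
      ≈⟨ coeff-scale a ((b ∷ g) *ₚ h) i ⟨
    coeff (scale a ((b ∷ g) *ₚ h)) i ∎

  *ₚ-scaleʳ : ∀ a f g → f *ₚ scale a g ≋ scale a (f *ₚ g)
  *ₚ-scaleʳ a f g = ≋-trans (*ₚ-comm f (scale a g)) (≋-trans (scale-*ₚ a g f) (scale-cong refl (*ₚ-comm g f)))

  *ₚ-negₚʳ : ∀ f g → f *ₚ negₚ g ≋ negₚ (f *ₚ g)
  *ₚ-negₚʳ f g =
    ≋-trans (*ₚ-congʳ f (negₚ≋scale-1 g)) (≋-trans (*ₚ-scaleʳ (- 1#) f g) (≋-sym (negₚ≋scale-1 (f *ₚ g))))

  *ₚ-distribˡ--ₚ : ∀ f g h → f *ₚ (g -ₚ h) ≋ f *ₚ g -ₚ f *ₚ h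
  *ₚ-distribˡ--ₚ f g h = ≋-trans (*ₚ-distribˡ-+ₚ f g (negₚ h)) (+ₚ-cong ≋-refl (*ₚ-negₚʳ f h))

  *ₚ-assoc : ∀ f g h → (f *ₚ g) *ₚ h ≋ f *ₚ (g *ₚ h)
  *ₚ-assoc []      g h .at i = refl
  *ₚ-assoc (a ∷ f) g h = ≋-trans (*ₚ-distribʳ-+ₚ h (scale a g) (0# ∷ f *ₚ g))
    (+ₚ-cong (scale-*ₚ a g h) (≋-trans 0∷-*ₚ (∷-cong refl (*ₚ-assoc f g h))))
    where
    0∷-*ₚ : (0# ∷ f *ₚ g) *ₚ h ≋ 0# ∷ (f *ₚ g) *ₚ h
    0∷-*ₚ .at i = trans (coeff-∷-*ₚ 0# (f *ₚ g) h i) (trans (+-cong (zeroˡ _) refl) (+-identityˡ _))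

  *ₚ-interchange : ∀ f g h k → (f *ₚ g) *ₚ (h *ₚ k) ≋ (h *ₚ f) *ₚ (g *ₚ k)
  *ₚ-interchange f g h k =
    ≋-trans (*ₚ-assoc f g (h *ₚ k))
    (≋-trans (*ₚ-congʳ f (≋-sym (*ₚ-assoc g h k)))
    (≋-trans (*ₚ-congʳ f (*ₚ-congˡ k (*ₚ-comm g h)))
    (≋-trans (*ₚ-congʳ f (*ₚ-assoc h g k))
    (≋-trans (≋-sym (*ₚ-assoc f h (g *ₚ k)))
    (*ₚ-congˡ (g *ₚ k) (*ₚ-comm f h))))))

  lead-*ₚ : ∀ f g m n → Deg< f (suc m) → Deg< g (suc n) →
            Deg< (f *ₚ g) (suc (m ℕ.+ n)) × coeff (f *ₚ g) (m ℕ.+ n) ≈ coeff f m * coeff g n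
  lead-*ₚ []      g m       n bf bg = (λ _ _ → refl) , sym (zeroˡ _)
  lead-*ₚ (a ∷ f) g zero    n bf bg = deg , top
    where
    X*fg≈0 : ∀ i → coeffX (f *ₚ g) i ≈ 0#
    X*fg≈0 = coeffX-IsZero (IsZero-*ₚˡ f g (Deg<-0⇒IsZero {f} (Deg<-tail {a} {f} bf)))
    deg : Deg< ((a ∷ f) *ₚ g) (suc n)
    deg i le = trans (coeff-∷-*ₚ a f g i)
      (trans (+-cong (trans (*-cong refl (bg i le)) (zeroʳ a)) (X*fg≈0 i)) (+-identityʳ 0#))
    top : coeff ((a ∷ f) *ₚ g) n ≈ a * coeff g n
    top = trans (coeff-∷-*ₚ a f g n) (trans (+-cong refl (X*fg≈0 n)) (+-identityʳ _))
  lead-*ₚ (a ∷ f) g (suc m) n bf bg = deg , top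
    where
    ih = lead-*ₚ f g m n (Deg<-tail bf) bg
    a*g≈0 : ∀ i → suc n ℕ.≤ i → a * coeff g i ≈ 0#
    a*g≈0 i le = trans (*-cong refl (bg i le)) (zeroʳ a)
    deg : Deg< ((a ∷ f) *ₚ g) (suc (suc m ℕ.+ n))
    deg (suc i) (s≤s le) = trans (coeff-∷-*ₚ a f g (suc i))
      (trans (+-cong (a*g≈0 (suc i) (s≤s (ℕP.≤-trans (ℕP.m≤n+m n m) (ℕP.≤-trans (ℕP.n≤1+n _) le))))
                     (proj₁ ih i le))
             (+-identityʳ 0#))
    top : coeff ((a ∷ f) *ₚ g) (suc m ℕ.+ n) ≈ coeff f m * coeff g n
    top = trans (coeff-∷-*ₚ a f g (suc (m ℕ.+ n)))
      (trans (+-cong (a*g≈0 (suc (m ℕ.+ n)) (s≤s (ℕP.m≤n+m n m))) (proj₂ ih)) (+-identityˡ _))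

  evalP : Poly → Carrier → Carrier
  evalP []      x = 0#
  evalP (a ∷ f) x = a + x * evalP f x

  evalP-congʳ : ∀ f {x y} → x ≈ y → evalP f x ≈ evalP f y
  evalP-congʳ []      p = refl
  evalP-congʳ (a ∷ f) p = +-cong refl (*-cong p (evalP-congʳ f p))

  evalP-IsZero : ∀ f x → IsZero f → evalP f x ≈ 0#
  evalP-IsZero []      x z = refl
  evalP-IsZero (a ∷ f) x z =
    trans (+-cong (z zero) (trans (*-cong refl (evalP-IsZero f x (IsZero-tail z))) (zeroʳ x))) (+-identityʳ _)

  evalP-congˡ : ∀ {f g} → f ≋ g → ∀ x → evalP f x ≈ evalP g x
  evalP-congˡ {[]}    {[]}    p x = refl
  evalP-congˡ {[]}    {b ∷ g} p x = sym (evalP-IsZero (b ∷ g) x (λ i → sym (at p i)))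
  evalP-congˡ {a ∷ f} {[]}    p x = evalP-IsZero (a ∷ f) x (at p)
  evalP-congˡ {a ∷ f} {b ∷ g} p x = +-cong (at p zero) (*-cong refl (evalP-congˡ (≋-tail p) x))

  evalP-+ₚ : ∀ f g x → evalP (f +ₚ g) x ≈ evalP f x + evalP g x
  evalP-+ₚ []      g       x = sym (+-identityˡ _)
  evalP-+ₚ (a ∷ f) []      x = sym (+-identityʳ _)
  evalP-+ₚ (a ∷ f) (b ∷ g) x = begin
    (a + b) + x * evalP (f +ₚ g) x        ≈⟨ +-cong refl (*-cong refl (evalP-+ₚ f g x)) ⟩
    (a + b) + x * (evalP f x + evalP g x) ≈⟨ solve 5 (λ a b x F G → ((a ⊕ b) ⊕ x ⊗ (F ⊕ G)) ⊜ ((a ⊕ x ⊗ F) ⊕ (b ⊕ x ⊗ G)))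
                                                   refl a b x (evalP f x) (evalP g x) ⟩
    (a + x * evalP f x) + (b + x * evalP g x) ∎

  evalP-negₚ : ∀ f x → evalP (negₚ f) x ≈ - evalP f x
  evalP-negₚ []      x = sym -0#≈0#
  evalP-negₚ (a ∷ f) x =
    trans (+-cong refl (trans (*-cong refl (evalP-negₚ f x)) (sym (-‿distribʳ-* x _)))) (-‿+-comm a _)

  evalP--ₚ : ∀ f g x → evalP (f -ₚ g) x ≈ evalP f x - evalP g x
  evalP--ₚ f g x = trans (evalP-+ₚ f (negₚ g) x) (+-cong refl (evalP-negₚ g x))

  evalP-scale : ∀ a f x → evalP (scale a f) x ≈ a * evalP f x
  evalP-scale a []      x = sym (zeroʳ a)
  evalP-scale a (b ∷ f) x = begin
    a * b + x * evalP (scale a f) x ≈⟨ +-cong refl (*-cong refl (evalP-scale a f x)) ⟩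
    a * b + x * (a * evalP f x)     ≈⟨ solve 4 (λ a b x F → (a ⊗ b ⊕ x ⊗ (a ⊗ F)) ⊜ (a ⊗ (b ⊕ x ⊗ F)))
                                               refl a b x (evalP f x) ⟩
    a * (b + x * evalP f x)         ∎

  evalP-*ₚ : ∀ f g x → evalP (f *ₚ g) x ≈ evalP f x * evalP g x
  evalP-*ₚ []      g x = sym (zeroˡ _)
  evalP-*ₚ (a ∷ f) g x = begin
    evalP (scale a g +ₚ (0# ∷ f *ₚ g)) x                ≈⟨ evalP-+ₚ (scale a g) _ x ⟩
    evalP (scale a g) x + (0# + x * evalP (f *ₚ g) x)    ≈⟨ +-cong (evalP-scale a g x)
                                                                  (+-cong refl (*-cong refl (evalP-*ₚ f g x))) ⟩
    a * evalP g x + (0# + x * (evalP f x * evalP g x))   ≈⟨ +-cong refl (+-identityˡ _) ⟩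
    a * evalP g x + x * (evalP f x * evalP g x)         ≈⟨ +-cong refl (*-assoc _ _ _) ⟨
    a * evalP g x + (x * evalP f x) * evalP g x         ≈⟨ distribʳ _ _ _ ⟨
    (a + x * evalP f x) * evalP g x                     ∎

  comp : Poly → Poly → Poly
  comp []      Q = []
  comp (a ∷ P) Q = (a ∷ []) +ₚ Q *ₚ comp P Q

  evalP-comp : ∀ P Q x → evalP (comp P Q) x ≈ evalP P (evalP Q x)
  evalP-comp []      Q x = refl
  evalP-comp (a ∷ P) Q x = begin
    evalP ((a ∷ []) +ₚ Q *ₚ comp P Q) x          ≈⟨ evalP-+ₚ (a ∷ []) (Q *ₚ comp P Q) x ⟩
    (a + x * 0#) + evalP (Q *ₚ comp P Q) x       ≈⟨ +-cong (trans (+-cong refl (zeroʳ x)) (+-identityʳ a))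
                                                          (evalP-*ₚ Q (comp P Q) x) ⟩
    a + evalP Q x * evalP (comp P Q) x           ≈⟨ +-cong refl (*-cong refl (evalP-comp P Q x)) ⟩
    a + evalP Q x * evalP P (evalP Q x)          ∎

  comp-congʳ : ∀ P {Q Q'} → Q ≋ Q' → comp P Q ≋ comp P Q'
  comp-congʳ []      Q≋Q' = ≋-refl
  comp-congʳ (a ∷ P) Q≋Q' = +ₚ-cong ≋-refl (*ₚ-cong Q≋Q' (comp-congʳ P Q≋Q'))

  IsZero-comp : ∀ P Q → IsZero P → IsZero (comp P Q)
  IsZero-comp []      Q z i = refl
  IsZero-comp (a ∷ P) Q z i = begin
    coeff ((a ∷ []) +ₚ Q *ₚ comp P Q) i          ≈⟨ coeff-+ₚ (a ∷ []) (Q *ₚ comp P Q) i ⟩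
    coeff (a ∷ []) i + coeff (Q *ₚ comp P Q) i   ≈⟨ +-cong (constant≈0 i)
                                                          (IsZero-*ₚʳ Q (comp P Q) (IsZero-comp P Q (IsZero-tail z)) i) ⟩
    0# + 0#                                      ≈⟨ +-identityʳ 0# ⟩
    0#                                           ∎
    where
    constant≈0 : ∀ i → coeff (a ∷ []) i ≈ 0#
    constant≈0 zero    = z zero
    constant≈0 (suc i) = refl

  lead-comp : ∀ P Q m n → Deg< P (suc m) → Deg< Q (suc (suc n)) →
    Deg< (comp P Q) (suc (m ℕ.* suc n)) × coeff (comp P Q) (m ℕ.* suc n) ≈ coeff P m * coeff Q (suc n) ^ m
  lead-comp []      Q m       n bP bQ = (λ _ _ → refl) , sym (zeroˡ _)
  lead-comp (a ∷ P) Q zero    n bP bQ = deg , top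
    where
    QP≈0 : IsZero (Q *ₚ comp P Q)
    QP≈0 = IsZero-*ₚʳ Q _ (IsZero-comp P Q (Deg<-0⇒IsZero {P} (Deg<-tail {a} {P} bP)))
    deg : Deg< (comp (a ∷ P) Q) 1
    deg (suc i) _ = trans (coeff-+ₚ (a ∷ []) (Q *ₚ comp P Q) (suc i))
                          (trans (+-cong refl (QP≈0 (suc i))) (+-identityʳ 0#))
    top : coeff (comp (a ∷ P) Q) 0 ≈ a * 1#
    top = trans (coeff-+ₚ (a ∷ []) (Q *ₚ comp P Q) 0)
      (trans (+-cong refl (QP≈0 0)) (trans (+-identityʳ a) (sym (*-identityʳ a))))
  lead-comp (a ∷ P) Q (suc m) n bP bQ = deg , top
    where
    ih = lead-comp P Q m n (Deg<-tail bP) bQ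
    lead-QP = lead-*ₚ Q (comp P Q) (suc n) (m ℕ.* suc n) bQ (proj₁ ih)
    deg : Deg< (comp (a ∷ P) Q) (suc (suc m ℕ.* suc n))
    deg (suc i) le = trans (coeff-+ₚ (a ∷ []) (Q *ₚ comp P Q) (suc i))
      (trans (+-cong refl (proj₁ lead-QP (suc i) le)) (+-identityʳ 0#))
    top : coeff (comp (a ∷ P) Q) (suc m ℕ.* suc n) ≈ coeff P m * coeff Q (suc n) ^ suc m
    top = begin
      coeff ((a ∷ []) +ₚ Q *ₚ comp P Q) (suc n ℕ.+ m ℕ.* suc n)
        ≈⟨ coeff-+ₚ (a ∷ []) (Q *ₚ comp P Q) (suc n ℕ.+ m ℕ.* suc n) ⟩
      0# + coeff (Q *ₚ comp P Q) (suc n ℕ.+ m ℕ.* suc n)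
        ≈⟨ trans (+-identityˡ _) (proj₂ lead-QP) ⟩
      coeff Q (suc n) * coeff (comp P Q) (m ℕ.* suc n)
        ≈⟨ *-cong refl (proj₂ ih) ⟩
      coeff Q (suc n) * (coeff P m * coeff Q (suc n) ^ m)
        ≈⟨ x*yz≈y*xz _ _ _ ⟩
      coeff P m * coeff Q (suc n) ^ suc m ∎

  X : Poly
  X = 0# ∷ 1# ∷ []

  iterate : Poly → ℕ → Poly
  iterate φ zero    = X
  iterate φ (suc k) = comp φ (iterate φ k)

  evalP-X : ∀ x → evalP X x ≈ x
  evalP-X x =
    trans (+-identityˡ _) (trans (*-cong refl (trans (+-cong refl (zeroʳ x)) (+-identityʳ 1#))) (*-identityʳ x))

  X- : Carrier → Poly
  X- α = - α ∷ 1# ∷ []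

  evalP-X- : ∀ α x → evalP (X- α) x ≈ x - α
  evalP-X- α x = begin
    - α + x * (1# + x * 0#) ≈⟨ +-cong refl (*-cong refl (trans (+-cong refl (zeroʳ x)) (+-identityʳ 1#))) ⟩
    - α + x * 1#             ≈⟨ trans (+-comm _ _) (+-cong (*-identityʳ x) refl) ⟩
    x - α                    ∎

  Deg<-X- : ∀ α → Deg< (X- α) 2
  Deg<-X- α (suc zero)    (s≤s ())
  Deg<-X- α (suc (suc i)) _        = refl

  evalP-Deg<1 : ∀ f x → Deg< f 1 → evalP f x ≈ coeff f 0
  evalP-Deg<1 []      x b = refl
  evalP-Deg<1 (a ∷ f) x b =
    trans (+-cong refl (trans (*-cong refl (evalP-IsZero f x (Deg<-0⇒IsZero {f} (Deg<-tail {a} {f} b)))) (zeroʳ x)))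
          (+-identityʳ a)

module PolynomialMap {c₁ ℓ₁ c₂ ℓ₂} {R : CommutativeRing c₁ ℓ₁} {S : CommutativeRing c₂ ℓ₂}
  {h : CommutativeRing.Carrier R → CommutativeRing.Carrier S}
  (hom : RingMorphisms.IsRingHomomorphism (CommutativeRing.rawRing R) (CommutativeRing.rawRing S) h) where

  module PR = Polynomial R
  module PS = Polynomial S
  module R = CommutativeRing R
  open CommutativeRing S
  open import Relation.Binary.Reasoning.Setoid setoid
  open RingMorphisms.IsRingHomomorphism hom
  open PS using (at)

  coeff-map : ∀ f i → PS.coeff (map h f) i ≈ h (PR.coeff f i)
  coeff-map []      i       = sym 0#-homo
  coeff-map (a ∷ f) zero    = refl
  coeff-map (a ∷ f) (suc i) = coeff-map f i

  map-cong : ∀ {f g} → f PR.≋ g → map h f PS.≋ map h g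
  map-cong {f} {g} p .at i = trans (coeff-map f i) (trans (⟦⟧-cong (PR.at p i)) (sym (coeff-map g i)))

  map-+ₚ : ∀ f g → map h (f PR.+ₚ g) PS.≋ map h f PS.+ₚ map h g
  map-+ₚ f g .at i = begin
    PS.coeff (map h (f PR.+ₚ g)) i                 ≈⟨ coeff-map (f PR.+ₚ g) i ⟩
    h (PR.coeff (f PR.+ₚ g) i)                     ≈⟨ ⟦⟧-cong (PR.coeff-+ₚ f g i) ⟩
    h (PR.coeff f i R.+ PR.coeff g i)              ≈⟨ +-homo _ _ ⟩
    h (PR.coeff f i) + h (PR.coeff g i)            ≈⟨ +-cong (coeff-map f i) (coeff-map g i) ⟨
    PS.coeff (map h f) i + PS.coeff (map h g) i    ≈⟨ PS.coeff-+ₚ (map h f) (map h g) i ⟨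
    PS.coeff (map h f PS.+ₚ map h g) i             ∎

  map-negₚ : ∀ f → map h (PR.negₚ f) PS.≋ PS.negₚ (map h f)
  map-negₚ f .at i = begin
    PS.coeff (map h (PR.negₚ f)) i   ≈⟨ coeff-map (PR.negₚ f) i ⟩
    h (PR.coeff (PR.negₚ f) i)       ≈⟨ ⟦⟧-cong (PR.coeff-negₚ f i) ⟩
    h (R.- PR.coeff f i)             ≈⟨ -‿homo _ ⟩
    - h (PR.coeff f i)               ≈⟨ -‿cong (coeff-map f i) ⟨
    - PS.coeff (map h f) i           ≈⟨ PS.coeff-negₚ (map h f) i ⟨
    PS.coeff (PS.negₚ (map h f)) i   ∎

  map--ₚ : ∀ f g → map h (f PR.-ₚ g) PS.≋ map h f PS.-ₚ map h g
  map--ₚ f g = PS.≋-trans (map-+ₚ f (PR.negₚ g)) (PS.+ₚ-cong PS.≋-refl (map-negₚ g))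

  map-scale : ∀ a f → map h (PR.scale a f) PS.≋ PS.scale (h a) (map h f)
  map-scale a f .at i = begin
    PS.coeff (map h (PR.scale a f)) i   ≈⟨ coeff-map (PR.scale a f) i ⟩
    h (PR.coeff (PR.scale a f) i)       ≈⟨ ⟦⟧-cong (PR.coeff-scale a f i) ⟩
    h (a R.* PR.coeff f i)              ≈⟨ *-homo _ _ ⟩
    h a * h (PR.coeff f i)              ≈⟨ *-cong refl (coeff-map f i) ⟨
    h a * PS.coeff (map h f) i          ≈⟨ PS.coeff-scale (h a) (map h f) i ⟨
    PS.coeff (PS.scale (h a) (map h f)) i ∎

  map-*ₚ : ∀ f g → map h (f PR.*ₚ g) PS.≋ map h f PS.*ₚ map h g
  map-*ₚ []      g = PS.≋-refl
  map-*ₚ (a ∷ f) g = PS.≋-trans (map-+ₚ (PR.scale a g) (R.0# ∷ f PR.*ₚ g))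
    (PS.+ₚ-cong (map-scale a g) (PS.∷-cong 0#-homo (map-*ₚ f g)))

  map-comp : ∀ P Q → map h (PR.comp P Q) PS.≋ PS.comp (map h P) (map h Q)
  map-comp []      Q = PS.≋-refl
  map-comp (a ∷ P) Q = PS.≋-trans (map-+ₚ (a ∷ []) (Q PR.*ₚ PR.comp P Q))
    (PS.+ₚ-cong PS.≋-refl (PS.≋-trans (map-*ₚ Q (PR.comp P Q)) (PS.*ₚ-cong (PS.≋-refl {map h Q}) (map-comp P Q))))

  map-Deg< : ∀ {f n} → PR.Deg< f n → PS.Deg< (map h f) n
  map-Deg< {f} b i le = trans (coeff-map f i) (trans (⟦⟧-cong (b i le)) 0#-homo)

  map-iterate : ∀ φ k → map h (PR.iterate φ k) PS.≋ PS.iterate (map h φ) k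
  map-iterate φ zero    = PS.∷-cong 0#-homo (PS.∷-cong 1#-homo PS.≋-refl)
  map-iterate φ (suc k) = PS.≋-trans (map-comp φ (PR.iterate φ k)) (PS.comp-congʳ (map h φ) (map-iterate φ k))

module FieldPolynomial {c ℓ} (F : Field c ℓ) where
  open Field F hiding (zero)
  open Polynomial commutativeRing public
  open import Algebra.Properties.Ring ring using (-0#≈0#)
  open import Algebra.Properties.CommutativeSemigroup +-commutativeSemigroup using () renaming (xy∙z≈xz∙y to xy+z≈xz+y)
  open import Relation.Binary.Reasoning.Setoid setoid

  x≈[x-y]+y : ∀ x y → x ≈ (x - y) + y
  x≈[x-y]+y x y = trans (sym (+-identityʳ x)) (trans (+-cong refl (sym (-‿inverseˡ y))) (sym (+-assoc _ _ _)))

  ≉0⇒cancelˡ : ∀ {x y} → ¬ x ≈ 0# → x * y ≈ 0# → y ≈ 0#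
  ≉0⇒cancelˡ {x} {y} x≉0 xy≈0 with inverse x x≉0
  ... | x⁻¹ , xx⁻¹≈1 = begin
    y              ≈⟨ *-identityˡ y ⟨
    1# * y         ≈⟨ *-cong (trans (sym xx⁻¹≈1) (*-comm x x⁻¹)) refl ⟩
    (x⁻¹ * x) * y  ≈⟨ *-assoc x⁻¹ x y ⟩
    x⁻¹ * (x * y)  ≈⟨ *-cong refl xy≈0 ⟩
    x⁻¹ * 0#       ≈⟨ zeroʳ x⁻¹ ⟩
    0#             ∎

  Deg<-*ₚ-cancelˡ : ∀ {f g e k} → Deg< f (suc e) → ¬ coeff f e ≈ 0# → Deg< (f *ₚ g) (e ℕ.+ k) → Deg< g k
  Deg<-*ₚ-cancelˡ {f} {g} {e} {k} bf lead≉0 bfg =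
    lower (length g) (Deg<-weaken {g} (ℕP.m≤m+n (length g) k) (Deg<-length g))
    where
    lower : ∀ j → Deg< g (j ℕ.+ k) → Deg< g k
    lower zero    bg = bg
    lower (suc j) bg = lower j bg′
      where
      top≈0 : coeff g (j ℕ.+ k) ≈ 0#
      top≈0 = ≉0⇒cancelˡ lead≉0 (trans (sym (proj₂ (lead-*ₚ f g e (j ℕ.+ k) bf bg)))
                                        (bfg _ (ℕP.+-monoʳ-≤ e (ℕP.m≤n+m k j))))
      bg′ : Deg< g (j ℕ.+ k)
      bg′ i le with ℕP.m≤n⇒m<n∨m≡n le
      ... | inj₁ lt    = bg i lt
      ... | inj₂ ≡.refl = top≈0

  monomial : Carrier → ℕ → Poly
  monomial t zero    = t ∷ []
  monomial t (suc n) = 0# ∷ monomial t n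

  Deg<-monomial : ∀ t n → Deg< (monomial t n) (suc n)
  Deg<-monomial t zero    (suc i) _        = refl
  Deg<-monomial t (suc n) (suc i) (s≤s le) = Deg<-monomial t n i le

  coeff-monomial : ∀ t n → coeff (monomial t n) n ≈ t
  coeff-monomial t zero    = refl
  coeff-monomial t (suc n) = coeff-monomial t n

  DivMod : Poly → ℕ → Poly → Set (c ⊔ ℓ)
  DivMod f e P = Σ Poly λ q → Σ Poly λ r → P ≋ f *ₚ q +ₚ r × Deg< r e

  divMod : ∀ {f e} → Deg< f (suc e) → ¬ coeff f e ≈ 0# → ∀ P → DivMod f e P
  divMod {f} {e} bf lead≉0 P = steps (length P) P (Deg<-weaken {P} (ℕP.m≤m+n (length P) e) (Deg<-length P))
    where
    lead⁻¹ = proj₁ (inverse (coeff f e) lead≉0)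

    -- each step subtracts a multiple of f that kills the coefficient of X^(N + e)
    steps : ∀ N P → Deg< P (N ℕ.+ e) → DivMod f e P
    steps zero    P bP = [] , P , P≋f*[]+P , bP
      where
      P≋f*[]+P : P ≋ f *ₚ [] +ₚ P
      P≋f*[]+P .at i = sym (trans (coeff-+ₚ (f *ₚ []) P i)
                                  (trans (+-cong (IsZero-*ₚʳ f [] (λ _ → refl) i) refl) (+-identityˡ _)))
    steps (suc N) P bP with steps N (P -ₚ m *ₚ f) bP-mf
      where
      t = coeff P (N ℕ.+ e) * lead⁻¹
      m = monomial t N
      lead-mf = lead-*ₚ m f N e (Deg<-monomial t N) bf
      top-mf : coeff (m *ₚ f) (N ℕ.+ e) ≈ coeff P (N ℕ.+ e)
      top-mf = begin
        coeff (m *ₚ f) (N ℕ.+ e)                       ≈⟨ proj₂ lead-mf ⟩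
        coeff m N * coeff f e                          ≈⟨ *-cong (coeff-monomial t N) refl ⟩
        (coeff P (N ℕ.+ e) * lead⁻¹) * coeff f e       ≈⟨ *-assoc _ _ _ ⟩
        coeff P (N ℕ.+ e) * (lead⁻¹ * coeff f e)       ≈⟨ *-cong refl (trans (*-comm _ _) (proj₂ (inverse (coeff f e) lead≉0))) ⟩
        coeff P (N ℕ.+ e) * 1#                         ≈⟨ *-identityʳ _ ⟩
        coeff P (N ℕ.+ e)                              ∎
      bP-mf : Deg< (P -ₚ m *ₚ f) (N ℕ.+ e)
      bP-mf i le with ℕP.m≤n⇒m<n∨m≡n le
      ... | inj₁ lt     = trans (coeff--ₚ P (m *ₚ f) i)
                            (trans (+-cong (bP i lt) (-‿cong (proj₁ lead-mf i lt))) (trans (+-identityˡ _) -0#≈0#))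
      ... | inj₂ ≡.refl = trans (coeff--ₚ P (m *ₚ f) i) (trans (+-cong (sym top-mf) refl) (-‿inverseʳ _))
    ... | q , r , eq , br = q +ₚ m , r , P≋ , br
      where
      t = coeff P (N ℕ.+ e) * lead⁻¹
      m = monomial t N
      P≋ : P ≋ f *ₚ (q +ₚ m) +ₚ r
      P≋ .at i = begin
        coeff P i                                            ≈⟨ x≈[x-y]+y _ _ ⟩
        (coeff P i - coeff (m *ₚ f) i) + coeff (m *ₚ f) i     ≈⟨ +-cong (sym (coeff--ₚ P (m *ₚ f) i)) (at (*ₚ-comm m f) i) ⟩
        coeff (P -ₚ m *ₚ f) i + coeff (f *ₚ m) i             ≈⟨ +-cong (trans (at eq i) (coeff-+ₚ (f *ₚ q) r i)) refl ⟩
        (coeff (f *ₚ q) i + coeff r i) + coeff (f *ₚ m) i    ≈⟨ xy+z≈xz+y _ _ _ ⟩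
        (coeff (f *ₚ q) i + coeff (f *ₚ m) i) + coeff r i    ≈⟨ +-cong (sym (coeff-+ₚ (f *ₚ q) (f *ₚ m) i)) refl ⟩
        coeff (f *ₚ q +ₚ f *ₚ m) i + coeff r i               ≈⟨ +-cong (sym (at (*ₚ-distribˡ-+ₚ f q m) i)) refl ⟩
        coeff (f *ₚ (q +ₚ m)) i + coeff r i                  ≈⟨ coeff-+ₚ (f *ₚ (q +ₚ m)) r i ⟨
        coeff (f *ₚ (q +ₚ m) +ₚ r) i                         ∎

  root⇒X-∣ : ∀ {α} G → evalP G α ≈ 0# → Σ Poly λ Q → G ≋ X- α *ₚ Q
  root⇒X-∣ {α} G Gα≈0 with divMod (Deg<-X- α) 1≉0 G
  ... | Q , r , G≋ , br = Q , ≋-trans G≋ (+ₚ-IsZeroʳ (X- α *ₚ Q) r≈0)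
    where
    r≈0 : IsZero r
    r≈0 zero    = begin
      coeff r 0                                       ≈⟨ evalP-Deg<1 r α br ⟨
      evalP r α                                       ≈⟨ +-identityˡ _ ⟨
      0# + evalP r α                                  ≈⟨ +-cong (sym (trans (*-cong (trans (evalP-X- α α) (-‿inverseʳ α)) refl)
                                                                            (zeroˡ _))) refl ⟩
      evalP (X- α) α * evalP Q α + evalP r α          ≈⟨ +-cong (evalP-*ₚ (X- α) Q α) refl ⟨
      evalP (X- α *ₚ Q) α + evalP r α                 ≈⟨ evalP-+ₚ (X- α *ₚ Q) r α ⟨
      evalP (X- α *ₚ Q +ₚ r) α                        ≈⟨ evalP-congˡ G≋ α ⟨
      evalP G α                                       ≈⟨ Gα≈0 ⟩
      0#                                              ∎
    r≈0 (suc i) = br (suc i) (s≤s z≤n)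


  X-∣-Deg< : ∀ {α G Q e} → Deg< G (suc (suc e)) → ¬ coeff G (suc e) ≈ 0# → G ≋ X- α *ₚ Q →
             Deg< Q (suc e) × ¬ coeff Q e ≈ 0#
  X-∣-Deg< {α} {G} {Q} {e} degG lead≉0 G≋ = degQ , leadQ≉0
    where
    degQ : Deg< Q (suc e)
    degQ = Deg<-*ₚ-cancelˡ {X- α} {Q} {1} {suc e} (Deg<-X- α) 1≉0 (Deg<-cong G≋ degG)
    leadQ≉0 : ¬ coeff Q e ≈ 0#
    leadQ≉0 Qe≈0 = lead≉0 (begin
      coeff G (suc e)              ≈⟨ at G≋ (suc e) ⟩
      coeff (X- α *ₚ Q) (1 ℕ.+ e)  ≈⟨ proj₂ (lead-*ₚ (X- α) Q 1 e (Deg<-X- α) degQ) ⟩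
      1# * coeff Q e               ≈⟨ *-cong refl Qe≈0 ⟩
      1# * 0#                      ≈⟨ zeroʳ 1# ⟩
      0#                           ∎)

  open FieldOps F using (_·_; eval; iter)

  coeff-tabulate : ∀ {n} (a : Fin n → Carrier) i → coeff (tabulate a) (toℕ i) ≡ a i
  coeff-tabulate a Fin.zero    = ≡.refl
  coeff-tabulate a (Fin.suc i) = coeff-tabulate (a ∘ Fin.suc) i

  Deg<-tabulate : ∀ {n} (a : Fin n → Carrier) → Deg< (tabulate a) n
  Deg<-tabulate a = ≡.subst (Deg< (tabulate a)) (ListP.length-tabulate a) (Deg<-length (tabulate a))

  tabulate-cong : ∀ {n} {a b : Fin n → Carrier} → (∀ i → a i ≈ b i) → tabulate a ≋ tabulate b
  tabulate-cong {zero}  a≈b = ≋-refl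
  tabulate-cong {suc n} a≈b = ∷-cong (a≈b Fin.zero) (tabulate-cong (a≈b ∘ Fin.suc))

  eval≡evalP-tabulate : ∀ n (a : Fin n → Carrier) x → eval n a x ≡ evalP (tabulate a) x
  eval≡evalP-tabulate zero    a x = ≡.refl
  eval≡evalP-tabulate (suc n) a x = ≡.cong (λ t → a Fin.zero + x * t) (eval≡evalP-tabulate n (a ∘ Fin.suc) x)

  eval-coeff : ∀ n f x → Deg< f n → eval n (coeff f ∘ toℕ) x ≈ evalP f x
  eval-coeff zero    f       x degf = sym (evalP-IsZero f x (Deg<-0⇒IsZero {f} degf))
  eval-coeff (suc n) []      x degf =
    trans (+-cong refl (trans (*-cong refl (eval-coeff n [] x (λ _ _ → refl))) (zeroʳ x))) (+-identityʳ _)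
  eval-coeff (suc n) (a ∷ f) x degf = +-cong refl (*-cong refl (eval-coeff n f x (Deg<-tail {a} {f} degf)))

  evalP-iterate : ∀ φ {f} → (∀ y → f y ≈ evalP φ y) → ∀ k y → evalP (iterate φ k) y ≈ iter k f y
  evalP-iterate φ     f≈φ zero    y = evalP-X y
  evalP-iterate φ {f} f≈φ (suc k) y = begin
    evalP (comp φ (iterate φ k)) y      ≈⟨ evalP-comp φ (iterate φ k) y ⟩
    evalP φ (evalP (iterate φ k) y)     ≈⟨ evalP-congʳ φ (evalP-iterate φ f≈φ k y) ⟩
    evalP φ (iter k f y)                ≈⟨ f≈φ (iter k f y) ⟨
    f (iter k f y)                      ∎

  ·≈·1#* : ∀ n x → n · x ≈ (n · 1#) * x
  ·≈·1#* zero    x = sym (zeroˡ x)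
  ·≈·1#* (suc n) x = trans (+-cong (sym (*-identityˡ x)) (·≈·1#* n x)) (sym (distribʳ x 1# (n · 1#)))

  ·-distribʳ-+ : ∀ m n x → (m ℕ.+ n) · x ≈ m · x + n · x
  ·-distribʳ-+ zero    n x = sym (+-identityˡ _)
  ·-distribʳ-+ (suc m) n x = trans (+-cong refl (·-distribʳ-+ m n x)) (sym (+-assoc _ _ _))

  *-·1# : ∀ m n → (m ℕ.* n) · 1# ≈ (m · 1#) * (n · 1#)
  *-·1# zero    n = sym (zeroˡ _)
  *-·1# (suc m) n = trans (·-distribʳ-+ n (m ℕ.* n) 1#)
    (trans (+-cong (sym (*-identityˡ _)) (*-·1# m n)) (sym (distribʳ _ _ _)))

module Valued {c ℓ} (K : Field c ℓ) (V : DiscreteValuation K) where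
  open Field K hiding (zero)
  open FieldPolynomial K public
  open DiscreteValuation V
  open import Algebra.Properties.Ring ring using (-1*x≈-x; -‿involutive; -0#≈0#)
  open import Algebra.Properties.AbelianGroup ℤP.+-0-abelianGroup using (identityˡ-unique; inverseʳ-unique)
  open import Algebra.Properties.CommutativeSemigroup ℤP.+-commutativeSemigroup using () renaming (x∙yz≈y∙xz to i+[j+k]≡j+[i+k])

  fin-injective : ∀ {m n} → fin m ≡ fin n → m ≡ n
  fin-injective ≡.refl = ≡.refl

  fin≤fin⁻¹ : ∀ {m n} → fin m ≤∞ fin n → m ℤ.≤ n
  fin≤fin⁻¹ (fin≤fin m≤n) = m≤n

  ≤∞-refl : ∀ {x} → x ≤∞ x
  ≤∞-refl {fin z} = fin≤fin ℤP.≤-refl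
  ≤∞-refl {∞}     = ∞ ≤∞∞

  ≤∞-trans : ∀ {x y z} → x ≤∞ y → y ≤∞ z → x ≤∞ z
  ≤∞-trans (fin≤fin p) (fin≤fin q) = fin≤fin (ℤP.≤-trans p q)
  ≤∞-trans p           (_ ≤∞∞)     = _ ≤∞∞

  fin-≤∞-trans : ∀ {m n x} → m ℤ.≤ n → fin n ≤∞ x → fin m ≤∞ x
  fin-≤∞-trans m≤n = ≤∞-trans (fin≤fin m≤n)

  min∞-glb : ∀ {m x y} → fin m ≤∞ x → fin m ≤∞ y → fin m ≤∞ min∞ x y
  min∞-glb {x = fin a} {fin b} (fin≤fin p) (fin≤fin q) = fin≤fin (ℤP.⊓-glb p q)
  min∞-glb {x = fin a} {∞}     p q = p
  min∞-glb {x = ∞}             p q = q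

  +∞-mono-≤ : ∀ {m n x y} → fin m ≤∞ x → fin n ≤∞ y → fin (m ℤ.+ n) ≤∞ x +∞ y
  +∞-mono-≤ (fin≤fin p) (fin≤fin q) = fin≤fin (ℤP.+-mono-≤ p q)
  +∞-mono-≤ {x = fin a} (fin≤fin p) (_ ≤∞∞) = _ ≤∞∞
  +∞-mono-≤ {x = ∞}     p           q       = _ ≤∞∞

  ≤∞∧≰∞-suc⇒≡ : ∀ {z t} → fin z ≤∞ t → ¬ fin (ℤ.suc z) ≤∞ t → t ≡ fin z
  ≤∞∧≰∞-suc⇒≡ (_ ≤∞∞) z+1≰∞ = ⊥-elim (z+1≰∞ (_ ≤∞∞))
  ≤∞∧≰∞-suc⇒≡ {z} (fin≤fin {n = w} z≤w) z+1≰w with w ℤP.≤? z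
  ... | yes w≤z = ≡.cong fin (ℤP.≤-antisym w≤z z≤w)
  ... | no  w≰z = ⊥-elim (z+1≰w (fin≤fin (ℤP.i<j⇒suc[i]≤j (ℤP.≰⇒> w≰z))))

  ≤v-cong : ∀ {m x y} → x ≈ y → m ≤∞ v x → m ≤∞ v y
  ≤v-cong x≈y = ≡.subst (_ ≤∞_) (v-cong x≈y)

  ≤v-0# : ∀ {m} → m ≤∞ v 0#
  ≤v-0# = ≡.subst (_ ≤∞_) (≡.sym v-0) (_ ≤∞∞)

  ≈0⇒v≡∞ : ∀ {x} → x ≈ 0# → v x ≡ ∞
  ≈0⇒v≡∞ x≈0 = ≡.trans (v-cong x≈0) v-0

  v≡fin⇒≉0 : ∀ {x z} → v x ≡ fin z → ¬ x ≈ 0#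
  v≡fin⇒≉0 vx≡z x≈0 with ≡.trans (≡.sym vx≡z) (≈0⇒v≡∞ x≈0)
  ... | ()

  ≈0? : ∀ x → x ≈ 0# ⊎ ¬ x ≈ 0#
  ≈0? x with v x in vx
  ... | ∞     = inj₁ (v-∞⇒0 x vx)
  ... | fin z = inj₂ (v≡fin⇒≉0 vx)

  v-+ : ∀ {m x y} → fin m ≤∞ v x → fin m ≤∞ v y → fin m ≤∞ v (x + y)
  v-+ p q = ≤∞-trans (min∞-glb p q) (v-ultra _ _)

  v-* : ∀ {m n x y} → fin m ≤∞ v x → fin n ≤∞ v y → fin (m ℤ.+ n) ≤∞ v (x * y)
  v-* {x = x} {y} p q = ≡.subst (_ ≤∞_) (≡.sym (v-mult x y)) (+∞-mono-≤ p q)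

  v-1# : v 1# ≡ fin (+ 0)
  v-1# with v 1# in v1
  ... | ∞     = ⊥-elim (1≉0 (v-∞⇒0 _ v1))
  ... | fin z = ≡.cong fin (identityˡ-unique z z (fin-injective (begin
    fin (z ℤ.+ z)   ≡⟨ ≡.cong₂ _+∞_ v1 v1 ⟨
    v 1# +∞ v 1#    ≡⟨ v-mult 1# 1# ⟨
    v (1# * 1#)     ≡⟨ v-cong (*-identityˡ 1#) ⟩
    v 1#            ≡⟨ v1 ⟩
    fin z           ∎)))
    where open ≡.≡-Reasoning

  [-1]²≈1 : - 1# * - 1# ≈ 1#
  [-1]²≈1 = trans (-1*x≈-x (- 1#)) (-‿involutive 1#)

  v-[-1#] : v (- 1#) ≡ fin (+ 0)
  v-[-1#] with v (- 1#) in v-1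
  ... | ∞     = ⊥-elim (1≉0 (trans (sym [-1]²≈1) (trans (*-cong (v-∞⇒0 _ v-1) refl) (zeroˡ _))))
  ... | fin w = ≡.cong fin (w+w≡0⇒w≡0 w (fin-injective (begin
    fin (w ℤ.+ w)         ≡⟨ ≡.cong₂ _+∞_ v-1 v-1 ⟨
    v (- 1#) +∞ v (- 1#)  ≡⟨ v-mult (- 1#) (- 1#) ⟨
    v (- 1# * - 1#)       ≡⟨ v-cong [-1]²≈1 ⟩
    v 1#                  ≡⟨ v-1# ⟩
    fin (+ 0)             ∎)))
    where
    open ≡.≡-Reasoning
    w+w≡0⇒w≡0 : ∀ w → w ℤ.+ w ≡ + 0 → w ≡ + 0
    w+w≡0⇒w≡0 (+ n)    w+w≡0 = ≡.cong +_ (ℕP.m+n≡0⇒m≡0 n (ℤP.+-injective w+w≡0))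
    w+w≡0⇒w≡0 -[1+ n ] ()

  v-- : ∀ {m x} → fin m ≤∞ v x → fin m ≤∞ v (- x)
  v-- {m} {x} p = ≤v-cong (-1*x≈-x x) (≡.subst (λ k → fin k ≤∞ _) (ℤP.+-identityˡ m) (v-* 0≤v[-1] p))
    where
    0≤v[-1] : fin (+ 0) ≤∞ v (- 1#)
    0≤v[-1] = ≡.subst (_ ≤∞_) (≡.sym v-[-1#]) ≤∞-refl

  v-+-strict : ∀ {x y z} → v x ≡ fin z → fin (ℤ.suc z) ≤∞ v y → v (x + y) ≡ fin z
  v-+-strict {x} {y} {z} vx≡z z<vy = ≤∞∧≰∞-suc⇒≡ z≤v[x+y] z≮v[x+y]
    where
    z≤vx : fin z ≤∞ v x
    z≤vx = ≡.subst (_ ≤∞_) (≡.sym vx≡z) ≤∞-refl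
    z≤v[x+y] : fin z ≤∞ v (x + y)
    z≤v[x+y] = v-+ z≤vx (fin-≤∞-trans (ℤP.i≤suc[i] z) z<vy)
    x≈[x+y]-y : (x + y) - y ≈ x
    x≈[x+y]-y = trans (+-assoc x y (- y)) (trans (+-cong refl (-‿inverseʳ y)) (+-identityʳ x))
    z≮v[x+y] : ¬ fin (ℤ.suc z) ≤∞ v (x + y)
    z≮v[x+y] z<v[x+y] = ℤP.<-irrefl ≡.refl (ℤP.suc[i]≤j⇒i<j (fin≤fin⁻¹ z<z))
      where
      z<z : fin (ℤ.suc z) ≤∞ fin z
      z<z = ≡.subst (_ ≤∞_) vx≡z (≤v-cong x≈[x+y]-y (v-+ z<v[x+y] (v-- z<vy)))

  infix 4 _≤v_
  _≤v_ : ℤ → Poly → Set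
  A ≤v f = ∀ i → fin A ≤∞ v (coeff f i)

  ≤v-+ₚ : ∀ {A} f g → A ≤v f → A ≤v g → A ≤v f +ₚ g
  ≤v-+ₚ f g A≤f A≤g i = ≤v-cong (sym (coeff-+ₚ f g i)) (v-+ (A≤f i) (A≤g i))

  ≤v--ₚ : ∀ {A} f g → A ≤v f → A ≤v g → A ≤v f -ₚ g
  ≤v--ₚ f g A≤f A≤g i = ≤v-cong (sym (coeff--ₚ f g i)) (v-+ (A≤f i) (v-- (A≤g i)))

  ≤v-*ₚ : ∀ {A B} f g → A ≤v f → B ≤v g → A ℤ.+ B ≤v f *ₚ g
  ≤v-*ₚ []      g A≤f B≤g i = ≤v-0#
  ≤v-*ₚ (a ∷ f) g A≤f B≤g i = ≤v-cong (sym (coeff-∷-*ₚ a f g i)) (v-+ (v-* (A≤f 0) (B≤g i)) (X*fg i))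
    where
    X*fg : ∀ i → fin _ ≤∞ v (coeffX (f *ₚ g) i)
    X*fg zero    = ≤v-0#
    X*fg (suc i) = ≤v-*ₚ f g (A≤f ∘ suc) B≤g i

  ≤v-comp : ∀ P Q → + 0 ≤v P → + 0 ≤v Q → + 0 ≤v comp P Q
  ≤v-comp []      Q 0≤P 0≤Q i = ≤v-0#
  ≤v-comp (a ∷ P) Q 0≤P 0≤Q =
    ≤v-+ₚ (a ∷ []) (Q *ₚ comp P Q) 0≤a (≤v-*ₚ Q (comp P Q) 0≤Q (≤v-comp P Q (0≤P ∘ suc) 0≤Q))
    where
    0≤a : + 0 ≤v a ∷ []
    0≤a zero    = 0≤P 0
    0≤a (suc i) = ≤v-0#

  record MinValuation (A : ℤ) (i₀ : ℕ) (f : Poly) : Set where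
    field
      attained   : v (coeff f i₀) ≡ fin A
      lowerBound : A ≤v f
      strictAfter : ∀ i → i₀ ℕ.< i → fin (ℤ.suc A) ≤∞ v (coeff f i)
  open MinValuation

  minValuation : ∀ f → IsZero f ⊎ Σ ℤ λ A → Σ ℕ λ i₀ → MinValuation A i₀ f
  minValuation []      = inj₁ (λ _ → refl)
  minValuation (a ∷ f) with minValuation f | v a in va
  ... | inj₁ f≈0 | ∞     = inj₁ λ { zero → v-∞⇒0 a va ; (suc i) → f≈0 i }
  ... | inj₁ f≈0 | fin A = inj₂ (A , 0 , record
    { attained    = va
    ; lowerBound  = λ { zero → ≡.subst (_ ≤∞_) (≡.sym va) ≤∞-refl ; (suc i) → ≤v-cong (sym (f≈0 i)) ≤v-0# }
    ; strictAfter = λ { (suc i) _ → ≤v-cong (sym (f≈0 i)) ≤v-0# } })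
  ... | inj₂ (B , i₀ , minB) | ∞ = inj₂ (B , suc i₀ , record
    { attained    = attained minB
    ; lowerBound  = λ { zero → ≡.subst (_ ≤∞_) (≡.sym va) (_ ≤∞∞) ; (suc i) → lowerBound minB i }
    ; strictAfter = λ { (suc i) (s≤s i₀<i) → strictAfter minB i i₀<i } })
  ... | inj₂ (B , i₀ , minB) | fin A with A ℤP.<? B
  ...   | yes A<B = inj₂ (A , 0 , record
    { attained    = va
    ; lowerBound  = λ { zero → ≡.subst (_ ≤∞_) (≡.sym va) ≤∞-refl ; (suc i) → fin-≤∞-trans (ℤP.<⇒≤ A<B) (lowerBound minB i) }
    ; strictAfter = λ { (suc i) _ → fin-≤∞-trans (ℤP.i<j⇒suc[i]≤j A<B) (lowerBound minB i) } })
  ...   | no  A≮B = inj₂ (B , suc i₀ , record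
    { attained    = attained minB
    ; lowerBound  = λ { zero → ≡.subst (_ ≤∞_) (≡.sym va) (fin≤fin (ℤP.≮⇒≥ A≮B)) ; (suc i) → lowerBound minB i }
    ; strictAfter = λ { (suc i) (s≤s i₀<i) → strictAfter minB i i₀<i } })

  gauss : ∀ {A B i₀ k₀} f g → MinValuation A i₀ f → MinValuation B k₀ g →
          v (coeff (f *ₚ g) (i₀ ℕ.+ k₀)) ≡ fin (A ℤ.+ B)
  gauss [] g minA minB with ≡.trans (≡.sym v-0) (attained minA)
  ... | ()
  gauss {A} {B} {zero} {k₀} (a ∷ f) g minA minB = ≡.trans (v-cong (coeff-∷-*ₚ a f g k₀))
    (v-+-strict (≡.trans (v-mult a (coeff g k₀)) (≡.cong₂ _+∞_ (attained minA) (attained minB))) (X*fg k₀))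
    where
    X*fg : ∀ i → fin (ℤ.suc (A ℤ.+ B)) ≤∞ v (coeffX (f *ₚ g) i)
    X*fg zero    = ≤v-0#
    X*fg (suc i) = ≡.subst (λ k → fin k ≤∞ _) (ℤP.+-assoc (+ 1) A B)
                     (≤v-*ₚ f g (λ j → strictAfter minA (suc j) (s≤s z≤n)) (lowerBound minB) i)
  gauss {A} {B} {suc i₀} {k₀} (a ∷ f) g minA minB = ≡.trans (v-cong (coeff-∷-*ₚ a f g (suc (i₀ ℕ.+ k₀))))
    (≡.trans (v-cong (+-comm _ _)) (v-+-strict (gauss f g minA′ minB) A+B<v[a*g]))
    where
    minA′ : MinValuation A i₀ f
    minA′ = record { attained = attained minA ; lowerBound = lowerBound minA ∘ suc
                   ; strictAfter = λ i i₀<i → strictAfter minA (suc i) (s≤s i₀<i) }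
    A+B<v[a*g] : fin (ℤ.suc (A ℤ.+ B)) ≤∞ v (a * coeff g (suc (i₀ ℕ.+ k₀)))
    A+B<v[a*g] = ≡.subst (λ k → fin k ≤∞ _) (i+[j+k]≡j+[i+k] A (+ 1) B)
                   (v-* (lowerBound minA 0) (strictAfter minB (suc (i₀ ℕ.+ k₀)) (s≤s (ℕP.m≤n+m k₀ i₀))))

  v-^ : ∀ x n → v x ≡ fin (+ 0) → v (x ^ n) ≡ fin (+ 0)
  v-^ x zero    vx≡0 = v-1#
  v-^ x (suc n) vx≡0 = ≡.trans (v-mult x (x ^ n)) (≡.cong₂ _+∞_ vx≡0 (v-^ x n vx≡0))

  record Good (n : ℕ) (P : Poly) : Set ℓ where
    field
      deg<      : Deg< P (suc n)
      lead-unit : v (coeff P n) ≡ fin (+ 0)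
      integral  : + 0 ≤v P
  open Good

  0≤v1# : fin (+ 0) ≤∞ v 1#
  0≤v1# = ≡.subst (_ ≤∞_) (≡.sym v-1#) ≤∞-refl

  Good-1# : Good 0 (1# ∷ [])
  Good-1# = record
    { deg<      = λ { (suc i) _ → refl }
    ; lead-unit = v-1#
    ; integral  = λ { zero → 0≤v1# ; (suc i) → ≤v-0# } }

  Good-X : Good 1 X
  Good-X = record
    { deg<      = λ { (suc zero) (s≤s ()) ; (suc (suc i)) _ → refl }
    ; lead-unit = v-1#
    ; integral  = λ { zero → ≤v-0# ; (suc zero) → 0≤v1# ; (suc (suc i)) → ≤v-0# } }

  Good-*ₚ : ∀ {m n P Q} → Good m P → Good n Q → Good (m ℕ.+ n) (P *ₚ Q)
  Good-*ₚ {m} {n} {P} {Q} gP gQ = record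
    { deg<      = proj₁ lead-PQ
    ; lead-unit = ≡.trans (v-cong (proj₂ lead-PQ)) (≡.trans (v-mult _ _) (≡.cong₂ _+∞_ (lead-unit gP) (lead-unit gQ)))
    ; integral  = ≤v-*ₚ P Q (integral gP) (integral gQ) }
    where lead-PQ = lead-*ₚ P Q m n (deg< gP) (deg< gQ)

  Good-comp : ∀ {m n P Q} → Good m P → Good n Q → 0 ℕ.< n → Good (m ℕ.* n) (comp P Q)
  Good-comp {m} {suc n} {P} {Q} gP gQ (s≤s z≤n) = record
    { deg<      = proj₁ lead-PQ
    ; lead-unit = ≡.trans (v-cong (proj₂ lead-PQ))
                    (≡.trans (v-mult _ _) (≡.cong₂ _+∞_ (lead-unit gP) (v-^ _ m (lead-unit gQ))))
    ; integral  = ≤v-comp P Q (integral gP) (integral gQ) }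
    where lead-PQ = lead-comp P Q m n (deg< gP) (deg< gQ)

  Good--ₚ : ∀ {n P Q} → Good n P → + 0 ≤v Q → Deg< Q n → Good n (P -ₚ Q)
  Good--ₚ {n} {P} {Q} gP 0≤Q degQ<n = record
    { deg<      = Deg<-+ₚ {P} {negₚ Q} (deg< gP) (Deg<-negₚ {Q} (Deg<-weaken {Q} (ℕP.n≤1+n n) degQ<n))
    ; lead-unit = ≡.trans (v-cong lead≈) (lead-unit gP)
    ; integral  = ≤v--ₚ P Q (integral gP) 0≤Q }
    where
    lead≈ : coeff (P -ₚ Q) n ≈ coeff P n
    lead≈ = trans (coeff--ₚ P Q n) (trans (+-cong refl (trans (-‿cong (degQ<n n ℕP.≤-refl)) -0#≈0#)) (+-identityʳ _))

  Good-cofactor-lead : ∀ {n e γ P f q} → Good n P → P ≋ f *ₚ q → Deg< f (suc e) → v (coeff f e) ≡ fin γ →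
                       Σ ℕ λ m → v (coeff q m) ≡ fin (ℤ.- γ)
  Good-cofactor-lead {n} {e} {γ} {P} {f} {q} gP P≋fq degf vf≡γ = byDegree (e ℕP.≤? n)
    where
    lead-f≉0 : ¬ coeff f e ≈ 0#
    lead-f≉0 = v≡fin⇒≉0 vf≡γ
    q≉0 : ¬ IsZero q
    q≉0 q≈0 = v≡fin⇒≉0 (lead-unit gP) (trans (at P≋fq n) (IsZero-*ₚʳ f q q≈0 n))
    byDegree : Dec (e ℕ.≤ n) → Σ ℕ λ m → v (coeff q m) ≡ fin (ℤ.- γ)
    byDegree (no e≰n) = ⊥-elim (q≉0 (Deg<-0⇒IsZero {q} (Deg<-*ₚ-cancelˡ {f} {q} {e} {0} degf lead-f≉0 degfq<e)))
      where
      degfq<e : Deg< (f *ₚ q) (e ℕ.+ 0)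
      degfq<e = Deg<-cong P≋fq (Deg<-weaken {P} (ℕP.≤-trans (ℕP.≰⇒> e≰n) (ℕP.m≤m+n e 0)) (deg< gP))
    byDegree (yes e≤n) = m , vq≡-γ
      where
      m = n ℕ.∸ e
      e+m≡n : e ℕ.+ m ≡ n
      e+m≡n = ℕP.m+[n∸m]≡n e≤n
      degq : Deg< q (suc m)
      degq = Deg<-*ₚ-cancelˡ {f} {q} {e} degf lead-f≉0
               (Deg<-cong P≋fq (≡.subst (Deg< P) (≡.trans (≡.cong suc (≡.sym e+m≡n)) (≡.sym (ℕP.+-suc e m))) (deg< gP)))
      γ+vq≡0 : fin γ +∞ v (coeff q m) ≡ fin (+ 0)
      γ+vq≡0 = begin
        fin γ +∞ v (coeff q m)            ≡⟨ ≡.cong (_+∞ v (coeff q m)) vf≡γ ⟨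
        v (coeff f e) +∞ v (coeff q m)    ≡⟨ v-mult _ _ ⟨
        v (coeff f e * coeff q m)         ≡⟨ v-cong (sym (proj₂ (lead-*ₚ f q e m degf degq))) ⟩
        v (coeff (f *ₚ q) (e ℕ.+ m))      ≡⟨ v-cong (sym (at P≋fq (e ℕ.+ m))) ⟩
        v (coeff P (e ℕ.+ m))             ≡⟨ ≡.cong (v ∘ coeff P) e+m≡n ⟩
        v (coeff P n)                     ≡⟨ lead-unit gP ⟩
        fin (+ 0)                         ∎
        where open ≡.≡-Reasoning
      vq≡-γ : v (coeff q m) ≡ fin (ℤ.- γ)
      vq≡-γ with v (coeff q m) | γ+vq≡0
      ... | fin δ | γ+δ≡0 = ≡.cong fin (inverseʳ-unique γ δ (fin-injective γ+δ≡0))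

  -- Gauss's lemma gives min v(f) + min v(q) = min v(P) ≥ 0, while min v(q) ≤ v(lead q) = −γ.
  Good-divisor-≤v : ∀ {n e γ P f q} → Good n P → P ≋ f *ₚ q → Deg< f (suc e) → v (coeff f e) ≡ fin γ → γ ≤v f
  Good-divisor-≤v {γ = γ} {f = f} {q} gP P≋fq degf vf≡γ
    with minValuation f | minValuation q | Good-cofactor-lead {f = f} {q} gP P≋fq degf vf≡γ
  ... | inj₁ f≈0 | _         | _          = ⊥-elim (v≡fin⇒≉0 vf≡γ (f≈0 _))
  ... | inj₂ _   | inj₁ q≈0  | m , vq≡-γ  = ⊥-elim (v≡fin⇒≉0 vq≡-γ (q≈0 m))
  ... | inj₂ (A , i₀ , minA) | inj₂ (B , k₀ , minB) | m , vq≡-γ = λ i → fin-≤∞-trans γ≤A (lowerBound minA i)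
    where
    0≤A+B : + 0 ℤ.≤ A ℤ.+ B
    0≤A+B = fin≤fin⁻¹ (≡.subst (_ ≤∞_) (≡.trans (v-cong (at P≋fq (i₀ ℕ.+ k₀))) (gauss f q minA minB))
                                      (integral gP (i₀ ℕ.+ k₀)))
    B≤-γ : B ℤ.≤ ℤ.- γ
    B≤-γ = fin≤fin⁻¹ (≡.subst (_ ≤∞_) vq≡-γ (lowerBound minB m))
    γ≤A : γ ℤ.≤ A
    γ≤A = begin
      γ                      ≡⟨ ℤP.+-identityʳ γ ⟨
      γ ℤ.+ + 0              ≤⟨ ℤP.+-monoʳ-≤ γ 0≤A+B ⟩
      γ ℤ.+ (A ℤ.+ B)        ≤⟨ ℤP.+-monoʳ-≤ γ (ℤP.+-monoʳ-≤ A B≤-γ) ⟩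
      γ ℤ.+ (A ℤ.+ ℤ.- γ)    ≡⟨ i+[j+k]≡j+[i+k] γ A (ℤ.- γ) ⟩
      A ℤ.+ (γ ℤ.+ ℤ.- γ)    ≡⟨ ≡.cong (λ k → A ℤ.+ k) (ℤP.+-inverseʳ γ) ⟩
      A ℤ.+ + 0              ≡⟨ ℤP.+-identityʳ A ⟩
      A                      ∎
      where open ℤP.≤-Reasoning

  open FieldOps K using (_·_)

  0≤v[n·1#] : ∀ n → fin (+ 0) ≤∞ v (n · 1#)
  0≤v[n·1#] zero    = ≤v-0#
  0≤v[n·1#] (suc n) = v-+ 0≤v1# (0≤v[n·1#] n)

  ∣⇒InMaxIdeal : ∀ {p d} → p ∣ d → InMaxIdeal (p · 1#) → InMaxIdeal (d · 1#)
  ∣⇒InMaxIdeal {p} {d} (divides k d≡k*p) p∈m =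
    ≤v-cong (sym (trans (reflexive (≡.cong (_· 1#) d≡k*p)) (*-·1# k p)))
            (v-* {+ 0} {+ 1} (0≤v[n·1#] k) p∈m)

  Good-iterate : ∀ {d φ} → Good d φ → 0 ℕ.< d → ∀ k → Good (d ℕ.^ k) (iterate φ k)
  Good-iterate         gφ 0<d zero    = Good-X
  Good-iterate {d}     gφ 0<d (suc k) =
    Good-comp gφ (Good-iterate gφ 0<d k) (ℕP.m^n>0 d {{ℕ.>-nonZero 0<d}} k)

  Good-iterate--ₚ : ∀ {d φ m n} → Good d φ → 1 ℕ.< d → m ℕ.< n → Good (d ℕ.^ n) (iterate φ n -ₚ iterate φ m)
  Good-iterate--ₚ {d} {φ} {m} {n} gφ 1<d m<n =
    Good--ₚ (Good-iterate gφ 0<d n) (integral (Good-iterate gφ 0<d m))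
            (Deg<-weaken {iterate φ m} (ℕP.^-monoʳ-< d 1<d m<n) (deg< (Good-iterate gφ 0<d m)))
    where
    0<d : 0 ℕ.< d
    0<d = ℕP.<-trans ℕ.z<s 1<d

  GoodReduction⇒Good : ∀ {d a} → GoodReduction K V d a → Good d (tabulate a)
  GoodReduction⇒Good {d} {a} (va≡0 , a-integral) = record
    { deg<      = Deg<-tabulate a
    ; lead-unit = ≡.subst (λ i → v (coeff (tabulate a) i) ≡ fin (+ 0)) (FinP.toℕ-fromℕ d)
                    (≡.trans (≡.cong v (coeff-tabulate a (fromℕ d))) va≡0)
    ; integral  = 0≤v-tabulate a a-integral }
    where
    0≤v-tabulate : ∀ {n} (a : Fin n → Carrier) → (∀ j → Integral (a j)) → + 0 ≤v tabulate a
    0≤v-tabulate {zero}  a a-int i       = ≤v-0#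
    0≤v-tabulate {suc n} a a-int zero    = a-int Fin.zero
    0≤v-tabulate {suc n} a a-int (suc i) = 0≤v-tabulate (a ∘ Fin.suc) (a-int ∘ Fin.suc) i

  v-lead-derivative : ∀ {p e} (a : Fin (suc (suc e)) → Carrier) → FieldOps.CharZero K → InMaxIdeal (p · 1#) → p ∣ suc e →
    GoodReduction K V (suc e) a → Σ ℤ λ γ → v (coeff (tabulate (FieldOps.deriv K (suc e) a)) e) ≡ fin γ × + 1 ℤ.≤ γ
  v-lead-derivative {e = e} a char0 p∈m p∣d (va≡0 , _) with v (suc e · 1#) in vd
  ... | ∞     = ⊥-elim (char0 e (v-∞⇒0 _ vd))
  ... | fin γ = γ , vlead≡γ , fin≤fin⁻¹ (≡.subst (_ ≤∞_) vd (∣⇒InMaxIdeal p∣d p∈m))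
    where
    φ′ = tabulate (FieldOps.deriv K (suc e) a)
    lead≡ : coeff φ′ e ≡ suc e · a (fromℕ (suc e))
    lead≡ = ≡.subst (λ i → coeff φ′ i ≡ suc i · a (fromℕ (suc e))) (FinP.toℕ-fromℕ e)
                    (coeff-tabulate (FieldOps.deriv K (suc e) a) (fromℕ e))
    vlead≡γ : v (coeff φ′ e) ≡ fin γ
    vlead≡γ = begin
      v (coeff φ′ e)                                   ≡⟨ v-cong (trans (reflexive lead≡) (·≈·1#* (suc e) _)) ⟩
      v ((suc e · 1#) * a (fromℕ (suc e)))             ≡⟨ v-mult _ _ ⟩
      v (suc e · 1#) +∞ v (a (fromℕ (suc e)))          ≡⟨ ≡.cong₂ _+∞_ vd va≡0 ⟩
      fin (γ ℤ.+ + 0)                                  ≡⟨ ≡.cong fin (ℤP.+-identityʳ γ) ⟩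
      fin γ                                            ∎
      where open ≡.≡-Reasoning

module OverAlgebraicClosure {c ℓ c' ℓ'} (K : Field c ℓ) (V : DiscreteValuation K) (Kbar : AlgebraicClosure K c' ℓ') where
  open Field K hiding (zero)
  open Valued K V
  open AlgebraicClosure Kbar public using (ι)
  open AlgebraicClosure Kbar using (L; ι-hom; closed; iter; FiniteOrbit)
  module L = Field L
  module PL = FieldPolynomial L
  open PL using () renaming (_≋_ to _≋ₗ_; _+ₚ_ to _+ₗ_; _-ₚ_ to _-ₗ_; _*ₚ_ to _*ₗ_)
  module ι = RingMorphisms.IsRingHomomorphism ι-hom
  open PolynomialMap {R = commutativeRing} {S = L.commutativeRing} ι-hom public
  open FieldOps K using (_·_; deriv)
  module OpsL = FieldOps L

  ι-≉0 : ∀ {x} → ¬ x ≈ 0# → ¬ ι x L.≈ L.0#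
  ι-≉0 {x} x≉0 ιx≈0 with inverse x x≉0
  ... | y , xy≈1 = L.1≉0 (begin
    L.1#           ≈⟨ ι.1#-homo ⟨
    ι 1#           ≈⟨ ι.⟦⟧-cong xy≈1 ⟨
    ι (x * y)      ≈⟨ ι.*-homo x y ⟩
    ι x L.* ι y    ≈⟨ L.*-cong ιx≈0 L.refl ⟩
    L.0# L.* ι y   ≈⟨ L.zeroˡ _ ⟩
    L.0#           ∎)
    where open import Relation.Binary.Reasoning.Setoid L.setoid

  ι≈0⇒≈0 : ∀ {x} → ι x L.≈ L.0# → x ≈ 0#
  ι≈0⇒≈0 {x} ιx≈0 with ≈0? x
  ... | inj₁ x≈0 = x≈0
  ... | inj₂ x≉0 = ⊥-elim (ι-≉0 x≉0 ιx≈0)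

  map-ι-≉0 : ∀ f {i} → ¬ coeff f i ≈ 0# → ¬ PL.coeff (map ι f) i L.≈ L.0#
  map-ι-≉0 f {i} fi≉0 ιfi≈0 = ι-≉0 fi≉0 (L.trans (L.sym (coeff-map f i)) ιfi≈0)

  ι-· : ∀ n x → ι (n · x) L.≈ OpsL._·_ n (ι x)
  ι-· zero    x = ι.0#-homo
  ι-· (suc n) x = L.trans (ι.+-homo x (n · x)) (L.+-cong L.refl (ι-· n x))

  root-exists : ∀ n G → PL.Deg< G (suc (suc n)) → ¬ PL.coeff G (suc n) L.≈ L.0# →
                Σ L.Carrier λ α → PL.evalP G α L.≈ L.0#
  root-exists n G degG lead≉0 with closed n (PL.coeff G ∘ toℕ) lead′≉0
    where
    lead′≉0 : ¬ PL.coeff G (toℕ (fromℕ (suc n))) L.≈ L.0#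
    lead′≉0 = ≡.subst (λ i → ¬ PL.coeff G i L.≈ L.0#) (≡.sym (FinP.toℕ-fromℕ (suc n))) lead≉0
  ... | α , Gα≈0 = α , L.trans (L.sym (PL.eval-coeff (suc (suc n)) G α degG)) Gα≈0

  RootsOfGood : PL.Poly → Set (c ⊔ ℓ ⊔ c' ⊔ ℓ')
  RootsOfGood G = ∀ β → PL.evalP G β L.≈ L.0# →
                  Σ ℕ λ n → Σ Poly λ P → Good n P × PL.evalP (map ι P) β L.≈ L.0#

  -- Split off a root α of G and multiply by a good polynomial vanishing at α.
  Good-multiple : ∀ e G → PL.Deg< G (suc e) → ¬ PL.coeff G e L.≈ L.0# → RootsOfGood G →
                  Σ ℕ λ n → Σ Poly λ P → Good n P × Σ PL.Poly λ H → map ι P ≋ₗ G *ₗ H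
  Good-multiple zero G degG lead≉0 roots with L.inverse (PL.coeff G 0) lead≉0
  ... | h , gh≈1 = 0 , 1# ∷ [] , Good-1# , h ∷ [] , PL.≋-trans ι1≋gh (PL.*ₚ-congˡ (h ∷ []) (PL.≋-sym G≋g))
    where
    G≋g : G ≋ₗ PL.coeff G 0 ∷ []
    G≋g = PL.mk≋ λ { zero → L.refl ; (suc i) → degG (suc i) (s≤s z≤n) }
    ι1≋gh : map ι (1# ∷ []) ≋ₗ (PL.coeff G 0 ∷ []) *ₗ (h ∷ [])
    ι1≋gh = PL.∷-cong (L.trans ι.1#-homo (L.trans (L.sym gh≈1) (L.sym (L.+-identityʳ _)))) PL.≋-refl
  Good-multiple (suc e) G degG lead≉0 roots
    with root-exists e G degG lead≉0
  ... | α , Gα≈0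
    with PL.root⇒X-∣ G Gα≈0 | roots α Gα≈0
  ... | Q , G≋[X-α]Q | n₀ , P₀ , g₀ , P₀α≈0
    with PL.X-∣-Deg< {α} {G} {Q} degG lead≉0 G≋[X-α]Q | PL.root⇒X-∣ (map ι P₀) P₀α≈0
  ... | degQ , leadQ≉0 | S , ιP₀≋[X-α]S
    with Good-multiple e Q degQ leadQ≉0 rootsQ
    where
    rootsQ : RootsOfGood Q
    rootsQ β Qβ≈0 = roots β (begin
      PL.evalP G β                                  ≈⟨ PL.evalP-congˡ G≋[X-α]Q β ⟩
      PL.evalP (PL.X- α *ₗ Q) β                     ≈⟨ PL.evalP-*ₚ (PL.X- α) Q β ⟩
      PL.evalP (PL.X- α) β L.* PL.evalP Q β         ≈⟨ L.*-cong L.refl Qβ≈0 ⟩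
      PL.evalP (PL.X- α) β L.* L.0#                 ≈⟨ L.zeroʳ _ ⟩
      L.0#                                          ∎)
      where open import Relation.Binary.Reasoning.Setoid L.setoid
  ... | n₁ , P₁ , g₁ , H₁ , ιP₁≋QH₁ = n₁ ℕ.+ n₀ , P₁ *ₚ P₀ , Good-*ₚ g₁ g₀ , H₁ *ₗ S , ιP≋GH
    where
    ιP≋GH : map ι (P₁ *ₚ P₀) ≋ₗ G *ₗ (H₁ *ₗ S)
    ιP≋GH = PL.≋-trans (map-*ₚ P₁ P₀) (PL.≋-trans (PL.*ₚ-cong ιP₁≋QH₁ ιP₀≋[X-α]S)
              (PL.≋-trans (PL.*ₚ-interchange Q H₁ (PL.X- α) S) (PL.*ₚ-congˡ (H₁ *ₗ S) (PL.≋-sym G≋[X-α]Q))))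

  -- The remainder r of P by f over K satisfies ι f · (H − ι q) = ι r, which forces r = 0 by degree.
  descend-∣ : ∀ {e f P H} → Deg< f (suc e) → ¬ coeff f e ≈ 0# →
              map ι P ≋ₗ map ι f *ₗ H → Σ Poly λ q → P ≋ f *ₚ q
  descend-∣ {e} {f} {P} {H} degf lead≉0 ιP≋ιfH with divMod {f} {e} degf lead≉0 P
  ... | q , r , P≋fq+r , degr = q , ≋-trans P≋fq+r (+ₚ-IsZeroʳ (f *ₚ q) r≈0)
    where
    ιP≋ιfιq+ιr : map ι P ≋ₗ map ι f *ₗ map ι q +ₗ map ι r
    ιP≋ιfιq+ιr = PL.≋-trans (map-cong P≋fq+r) (PL.≋-trans (map-+ₚ (f *ₚ q) r) (PL.+ₚ-cong (map-*ₚ f q) PL.≋-refl))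
    ιf[H-ιq]≋ιr : map ι f *ₗ (H -ₗ map ι q) ≋ₗ map ι r
    ιf[H-ιq]≋ιr = begin
      map ι f *ₗ (H -ₗ map ι q)                         ≈⟨ PL.*ₚ-distribˡ--ₚ (map ι f) H (map ι q) ⟩
      map ι f *ₗ H -ₗ map ι f *ₗ map ι q                ≈⟨ PL.-ₚ-cong (PL.≋-trans (PL.≋-sym ιP≋ιfH) ιP≋ιfιq+ιr) PL.≋-refl ⟩
      (map ι f *ₗ map ι q +ₗ map ι r) -ₗ map ι f *ₗ map ι q  ≈⟨ PL.+ₚ--ₚ-cancelˡ (map ι f *ₗ map ι q) (map ι r) ⟩
      map ι r                                           ∎
      where open import Relation.Binary.Reasoning.Setoid PL.≋-setoid
    H-ιq≈0 : PL.IsZero (H -ₗ map ι q)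
    H-ιq≈0 = PL.Deg<-0⇒IsZero {H -ₗ map ι q}
      (PL.Deg<-*ₚ-cancelˡ {map ι f} {H -ₗ map ι q} {e} {0} (map-Deg< {f} degf) (map-ι-≉0 f lead≉0)
        (PL.Deg<-cong (PL.≋-sym ιf[H-ιq]≋ιr) (map-Deg< {r} (Deg<-weaken {r} (ℕP.m≤m+n e 0) degr))))
    r≈0 : IsZero r
    r≈0 i = ι≈0⇒≈0 (L.trans (L.sym (coeff-map r i))
                     (L.trans (L.sym (PL.at ιf[H-ιq]≋ιr i)) (PL.IsZero-*ₚʳ (map ι f) (H -ₗ map ι q) H-ιq≈0 i)))

  finiteOrbit⇒collision : ∀ {f α} → FiniteOrbit f α → Σ ℕ λ m → Σ ℕ λ n → m ℕ.< n × iter m f α L.≈ iter n f α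
  finiteOrbit⇒collision (N , orbit , covered) with FinP.pigeonhole (ℕP.n<1+n N) (λ k → proj₁ (covered (toℕ k)))
  ... | i , j , i<j , same = toℕ i , toℕ j , i<j ,
    L.trans (proj₂ (covered (toℕ i))) (L.trans (L.reflexive (≡.cong orbit same)) (L.sym (proj₂ (covered (toℕ j)))))

  -- a critical point β of φ with φ^m(β) = φ^n(β) is a root of φ^n − φ^m
  criticalPoints⇒RootsOfGood : ∀ {d a} → 1 ℕ.< d → GoodReduction K V d a → PostCriticallyFinite K Kbar d a →
                               RootsOfGood (map ι (tabulate (deriv d a)))
  criticalPoints⇒RootsOfGood {d} {a} 1<d good pcf β φ′β≈0
    with finiteOrbit⇒collision (pcf β critical)
    where
    ιφ′≋ : tabulate (OpsL.deriv d (ι ∘ a)) PL.≋ map ι (tabulate (deriv d a))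
    ιφ′≋ = PL.≋-trans (PL.tabulate-cong (λ j → L.sym (ι-· (suc (toℕ j)) (a (Fin.suc j)))))
                      (PL.≋-reflexive (≡.sym (ListP.map-tabulate (deriv d a) ι)))
    critical : OpsL.eval d (OpsL.deriv d (ι ∘ a)) β L.≈ L.0#
    critical = L.trans (L.reflexive (PL.eval≡evalP-tabulate d _ β)) (L.trans (PL.evalP-congˡ ιφ′≋ β) φ′β≈0)
  ... | m , n , m<n , φᵐβ≈φⁿβ =
    d ℕ.^ n , iterate φ n -ₚ iterate φ m , Good-iterate--ₚ (GoodReduction⇒Good good) 1<d m<n , root
    where
    φ = tabulate a
    f = OpsL.eval (suc d) (ι ∘ a)
    f≈ιφ : ∀ y → f y L.≈ PL.evalP (map ι φ) y
    f≈ιφ y = L.reflexive (≡.trans (PL.eval≡evalP-tabulate (suc d) (ι ∘ a) y)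
                                   (≡.cong (λ g → PL.evalP g y) (≡.sym (ListP.map-tabulate a ι))))
    evalP-ιφᵏ : ∀ k → PL.evalP (map ι (iterate φ k)) β L.≈ iter k f β
    evalP-ιφᵏ k = L.trans (PL.evalP-congˡ (map-iterate φ k) β) (PL.evalP-iterate (map ι φ) f≈ιφ k β)
    root : PL.evalP (map ι (iterate φ n -ₚ iterate φ m)) β L.≈ L.0#
    root = begin
      PL.evalP (map ι (iterate φ n -ₚ iterate φ m)) β
        ≈⟨ PL.evalP-congˡ (map--ₚ (iterate φ n) (iterate φ m)) β ⟩
      PL.evalP (map ι (iterate φ n) -ₗ map ι (iterate φ m)) β
        ≈⟨ PL.evalP--ₚ (map ι (iterate φ n)) (map ι (iterate φ m)) β ⟩
      PL.evalP (map ι (iterate φ n)) β L.- PL.evalP (map ι (iterate φ m)) β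
        ≈⟨ L.+-cong (evalP-ιφᵏ n) (L.-‿cong (evalP-ιφᵏ m)) ⟩
      iter n f β L.- iter m f β
        ≈⟨ L.+-cong (L.sym φᵐβ≈φⁿβ) L.refl ⟩
      iter m f β L.- iter m f β
        ≈⟨ L.-‿inverseʳ _ ⟩
      L.0# ∎
      where open import Relation.Binary.Reasoning.Setoid L.setoid

lemma4p3 : ∀ {c ℓ c' ℓ' : Level} (K : Field c ℓ) →
    FieldOps.CharZero K →
    (V : DiscreteValuation K) →
    (p : ℕ) → Prime p →
    DiscreteValuation.InMaxIdeal V (FieldOps._·_ K p (Field.1# K)) →
    (Kbar : AlgebraicClosure K c' ℓ') →
    (d : ℕ) → (a : Fin (suc d) → Field.Carrier K) →
    p ∣ d →
    GoodReduction K V d a →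
    PostCriticallyFinite K Kbar d a →
    ∀ (j : Fin d) → DiscreteValuation.InMaxIdeal V (FieldOps.deriv K d a j)
lemma4p3 K char0 V p p-prime p∈m Kbar zero    a p∣d good pcf ()
lemma4p3 K char0 V p p-prime p∈m Kbar (suc e) a p∣d good pcf j =
  let γ , vφ′≡γ , 1≤γ          = v-lead-derivative a char0 p∈m p∣d good
      φ′≉0                     = v≡fin⇒≉0 vφ′≡γ
      n , P , gP , H , ιP≋ιφ′H = Good-multiple e (map ι φ′) (map-Deg< {φ′} degφ′) (map-ι-≉0 φ′ {e} φ′≉0)
                                   (criticalPoints⇒RootsOfGood 1<d good pcf)
      q , P≋φ′q                = descend-∣ {e} {φ′} degφ′ φ′≉0 ιP≋ιφ′H
      γ≤vφ′                    = Good-divisor-≤v gP P≋φ′q degφ′ vφ′≡γ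
  in ≡.subst (λ x → fin (+ 1) ≤∞ v x) (coeff-tabulate (deriv (suc e) a) j)
             (fin-≤∞-trans 1≤γ (γ≤vφ′ (toℕ j)))
  where
  open FieldOps K using (deriv)
  open DiscreteValuation V using (v)
  open Valued K V
  open OverAlgebraicClosure K V Kbar

  φ′ : Poly
  φ′ = tabulate (deriv (suc e) a)

  degφ′ : Deg< φ′ (suc e)
  degφ′ = Deg<-tabulate (deriv (suc e) a)

  1<d : 1 ℕ.< suc e
  1<d = ℕP.<-≤-trans (ℕ.nonTrivial⇒n>1 p {{prime⇒nonTrivial p-prime}}) (∣⇒≤ p∣d)
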